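{- Let $W$ be a finite crystallographic Coxeter group with simple generators $S$. The generating function $\sum_A q^{|A|}$ over antichains $A$ in the doubled root poset of $W$ equals \[\sum q^{|M|}\operatorname{Cat}^{+\!\!+}(W_I;q)\operatorname{Cat}^{+\!\!+}(W_J;q),\] the sum over all ordered triples $(I,J,M)$ of pairwise disjoint subsets of $S$.
   Context: Root poset: positive roots of a crystallographic root system for $W$ with $\alpha\le\beta$ iff $\beta-\alpha$ is a nonnegative combination of simple roots. Doubled root poset: a top copy of the root poset and a bottom copy of its dual glued along the simple roots; a bottom element $\gamma$ is below a top element $\beta$ iff their supports intersect. $W_J$ is the standard parabolic subgroup generated by $J\subseteq S$. $c$-sortable: for a Coxeter element $c$ with reduced word $a_1\cdots a_n$, the $c$-sorting word of $w$ is the leftmost subword of $a_1\cdots a_na_1\cdots a_n\cdots$ reduced for $w$; with $K_i$ the letters from the $i$-th copy, $w$ is $c$-sortable iff $K_1\supseteq K_2\supseteq\cdots$. $\operatorname{Cat}(W;q)=\sum_k\operatorname{Nar}_k(W)q^k$ where $\operatorname{Nar}_k(W)$ is the number of $c$-sortable elements with $k$ descents (equivalently, of $k$-element antichains in the root poset). $\operatorname{Cat}^+(W;q)=\sum_{J\subseteq S}(-1)^{|S|-|J|}\operatorname{Cat}(W_J;q)$, $\operatorname{Cat}^{+\!\!+}(W;q)=\sum_{J\subseteq S}(-q)^{|S|-|J|}\operatorname{Cat}^+(W_J;q)$. -}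

module Defs where

open import Data.Nat as ℕ using (ℕ; zero; suc; _∸_)
open import Data.Integer as ℤ using (ℤ; +_; _+_; _*_; -_; _-_; _^_; 0ℤ; 1ℤ)
open import Data.Fin using (Fin; zero; suc)
import Data.Fin as Fin
open import Data.Vec as Vec using (Vec; []; _∷_; lookup; tabulate)
import Data.Vec.Properties as VecP
open import Data.List as List using (List; []; _∷_; _++_; map; length; allFin; filterᵇ)
import Data.List.Relation.Unary.Unique.Propositional as UniqueP
open import Data.List.Membership.Propositional using (_∈_)
open import Data.Bool using (Bool; true; false; if_then_else_; _∧_; _∨_; not)
open import Data.Product using (_×_)
open import Relation.Nullary.Decidable using (⌊_⌋)
open import Relation.Binary.PropositionalEquality using (_≡_; _≢_)
open import Function.Bundles using (_⇔_)

allᵇ : {X : Set} → (X → Bool) → List X → Bool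
allᵇ p [] = true
allᵇ p (x ∷ xs) = p x ∧ allᵇ p xs

anyᵇ : {X : Set} → (X → Bool) → List X → Bool
anyᵇ p [] = false
anyᵇ p (x ∷ xs) = p x ∨ anyᵇ p xs

sumℤ : List ℤ → ℤ
sumℤ = List.foldr _+_ 0ℤ

sublists : {X : Set} → List X → List (List X)
sublists [] = [] ∷ []
sublists (x ∷ xs) = sublists xs ++ map (x ∷_) (sublists xs)

-- pairwise incomparability of the entries of a list w.r.t. a
-- (symmetric) Boolean comparability relation
pairwiseIncomparable : {X : Set} → (X → X → Bool) → List X → Bool
pairwiseIncomparable comp [] = true
pairwiseIncomparable comp (x ∷ xs) =
  allᵇ (λ y → not (comp x y)) xs ∧ pairwiseIncomparable comp xs

-- generating function  Σ_{antichains A} q^{|A|}  over the (duplicate free)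
-- list xs of elements of a finite poset, given its comparability relation
antichainGF : {X : Set} → (X → X → Bool) → List X → ℤ → ℤ
antichainGF comp xs q =
  sumℤ (map (λ s → q ^ length s) (filterᵇ (pairwiseIncomparable comp) (sublists xs)))

Subset : ℕ → Set
Subset n = Vec Bool n

allSubsets : (n : ℕ) → List (Subset n)
allSubsets zero = [] ∷ []
allSubsets (suc n) = map (false ∷_) (allSubsets n) ++ map (true ∷_) (allSubsets n)

card : {n : ℕ} → Subset n → ℕ
card [] = 0
card (true ∷ p) = suc (card p)
card (false ∷ p) = card p

_⊆ᵇ_ : {n : ℕ} → Subset n → Subset n → Bool
p ⊆ᵇ r = allᵇ (λ k → not (lookup p k) ∨ lookup r k) (allFin _)

disjointᵇ : {n : ℕ} → Subset n → Subset n → Bool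
disjointᵇ p r = allᵇ (λ k → not (lookup p k ∧ lookup r k)) (allFin _)

-- Crystallographic root systems from (generalized) Cartan matrices.
-- Roots are written in coordinates w.r.t. the simple roots α_1..α_n.

CartanMatrix : ℕ → Set
CartanMatrix n = Fin n → Fin n → ℤ

IsGCM : {n : ℕ} → CartanMatrix n → Set
IsGCM {n} A =
  (∀ i → A i i ≡ + 2) ×
  (∀ i j → i ≢ j → A i j ℤ.≤ 0ℤ) ×
  (∀ i j → A i j ≡ 0ℤ → A j i ≡ 0ℤ)

simpleRoot : {n : ℕ} → Fin n → Vec ℤ n
simpleRoot i = tabulate (λ k → if ⌊ k Fin.≟ i ⌋ then 1ℤ else 0ℤ)

pairing : {n : ℕ} → CartanMatrix n → Fin n → Vec ℤ n → ℤ
pairing A i v = sumℤ (map (λ j → A i j * lookup v j) (allFin _))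

-- simple reflection s_i v = v - ⟨α_i^∨, v⟩ α_i
reflect : {n : ℕ} → CartanMatrix n → Fin n → Vec ℤ n → Vec ℤ n
reflect A i v =
  tabulate (λ k → if ⌊ k Fin.≟ i ⌋ then lookup v k - pairing A i v else lookup v k)

-- roots: the orbit of the simple roots under the Weyl group W
data IsRoot {n : ℕ} (A : CartanMatrix n) : Vec ℤ n → Set where
  simple  : ∀ i → IsRoot A (simpleRoot i)
  reflected : ∀ i {v} → IsRoot A v → IsRoot A (reflect A i v)

IsPositiveRoot : {n : ℕ} → CartanMatrix n → Vec ℤ n → Set
IsPositiveRoot A v = IsRoot A v × (∀ k → 0ℤ ℤ.≤ lookup v k)

-- L is a duplicate-free list of exactly the positive roots
-- (its existence is the finiteness of the root system / of W)
PositiveRootList : {n : ℕ} → CartanMatrix n → List (Vec ℤ n) → Set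
PositiveRootList A L = UniqueP.Unique L × (∀ v → (v ∈ L) ⇔ IsPositiveRoot A v)

-- Root poset:  α ≤ β  iff  β - α is a nonnegative combination of simple roots

rootLeqᵇ : {n : ℕ} → Vec ℤ n → Vec ℤ n → Bool
rootLeqᵇ u v = allᵇ (λ k → ⌊ lookup u k ℤ.≤? lookup v k ⌋) (allFin _)

rootComparableᵇ : {n : ℕ} → Vec ℤ n → Vec ℤ n → Bool
rootComparableᵇ u v = rootLeqᵇ u v ∨ rootLeqᵇ v u

nonzeroᵇ : ℤ → Bool
nonzeroᵇ x = not ⌊ x ℤ.≟ 0ℤ ⌋

supportsMeetᵇ : {n : ℕ} → Vec ℤ n → Vec ℤ n → Bool
supportsMeetᵇ u v = anyᵇ (λ k → nonzeroᵇ (lookup u k) ∧ nonzeroᵇ (lookup v k)) (allFin _)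

isSimpleᵇ : {n : ℕ} → Vec ℤ n → Bool
isSimpleᵇ v = anyᵇ (λ i → ⌊ VecP.≡-dec ℤ._≟_ v (simpleRoot i) ⌋) (allFin _)

supportedInᵇ : {n : ℕ} → Subset n → Vec ℤ n → Bool
supportedInᵇ J v = allᵇ (λ k → not (nonzeroᵇ (lookup v k)) ∨ lookup J k) (allFin _)

-- Cat(W_J; q), the positive roots of W_J being those supported in J
Cat : {n : ℕ} → List (Vec ℤ n) → Subset n → ℤ → ℤ
Cat L J q = antichainGF rootComparableᵇ (filterᵇ (supportedInᵇ J) L) q

CatPlus : {n : ℕ} → List (Vec ℤ n) → Subset n → ℤ → ℤ
CatPlus {n} L J q =
  sumℤ (map (λ K → ((- 1ℤ) ^ (card J ∸ card K)) * Cat L K q)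
            (filterᵇ (λ K → K ⊆ᵇ J) (allSubsets n)))

CatPlusPlus : {n : ℕ} → List (Vec ℤ n) → Subset n → ℤ → ℤ
CatPlusPlus {n} L J q =
  sumℤ (map (λ K → ((- q) ^ (card J ∸ card K)) * CatPlus L K q)
            (filterᵇ (λ K → K ⊆ᵇ J) (allSubsets n)))

data DElt (n : ℕ) : Set where
  top : Vec ℤ n → DElt n
  bot : Vec ℤ n → DElt n   -- bottom (dual) copy, non-simple roots only

-- elements: all top β, and bot γ for non-simple γ (simple roots glued)
doubledElements : {n : ℕ} → List (Vec ℤ n) → List (DElt n)
doubledElements L =
  map top L ++ map bot (filterᵇ (λ v → not (isSimpleᵇ v)) L)

doubledComparableᵇ : {n : ℕ} → DElt n → DElt n → Bool
doubledComparableᵇ (top u) (top v) = rootComparableᵇ u v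
doubledComparableᵇ (bot u) (bot v) = rootComparableᵇ u v
doubledComparableᵇ (top u) (bot v) = supportsMeetᵇ u v
doubledComparableᵇ (bot u) (top v) = supportsMeetᵇ u v

doubledAntichainGF : {n : ℕ} → List (Vec ℤ n) → ℤ → ℤ
doubledAntichainGF L q = antichainGF doubledComparableᵇ (doubledElements L) q

tripleSum : {n : ℕ} → List (Vec ℤ n) → ℤ → ℤ
tripleSum {n} L q =
  sumℤ (map (λ I → sumℤ (map (λ J → sumℤ (map (λ M →
     if disjointᵇ I J ∧ disjointᵇ I M ∧ disjointᵇ J M
     then (q ^ card M) * (CatPlusPlus L I q * CatPlusPlus L J q)
     else 0ℤ) (allSubsets n))) (allSubsets n))) (allSubsets n))

-- An antichain of positive roots consists of a set of simple roots, indexed by some M ⊆ S,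
-- and an antichain B of non-simple roots.  Since a simple root αᵢ lies below a positive root β
-- iff i ∈ supp β, the only constraint between the two parts is that M and supp B are disjoint.
-- Writing G(T) for the generating function of antichains of non-simple roots with support
-- exactly T, this gives Cat(W_K; q) = Σ_{T ⊆ K} G(T) (1 + q)^|K ∖ T|.
--
-- Indexed by subsets, this expansion and the alternating sums defining Cat⁺ and Cat⁺⁺ are
-- Kronecker powers of the 2 × 2 matrices (1 x ; 0 1) with x = 1 + q, -1 and -q.  Such matrices
-- compose by adding x, so Cat⁺(W_J; q) = Σ_{T ⊆ J} G(T) q^|J ∖ T| and Cat⁺⁺(W_I; q) = G(I).
--
-- An antichain of the doubled root poset is an antichain A of the top copy together with an
-- antichain B of non-simple roots in the bottom copy such that supp A and supp B are disjoint.
-- Splitting A as above, with I the support of its non-simple part and J = supp B, yields a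
-- pairwise disjoint triple (I, J, M) and the weight q^|M| G(I) G(J).

module Submission where

open import Defs
open import Data.Nat using (ℕ)
open import Data.Integer using (ℤ)
open import Data.List using (List)
open import Data.Vec using (Vec)
open import Relation.Binary.PropositionalEquality using (_≡_)

open import Data.Nat as ℕ using (zero; suc; _∸_)
import Data.Nat.Properties as ℕP
open import Data.Integer as ℤ using (+_; _+_; _*_; -_; _-_; _^_; 0ℤ; 1ℤ)
import Data.Integer.Properties as ℤP
open import Data.Integer.Tactic.RingSolver using (solve-∀)
open import Algebra.Properties.CommutativeSemigroup ℤP.*-commutativeSemigroup
  using (x∙yz≈y∙xz; xy∙z≈y∙xz) renaming (interchange to *-interchange)
open import Algebra.Properties.CommutativeSemigroup ℤP.+-commutativeSemigroup
  using () renaming (interchange to +-interchange)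
open import Data.Bool using (Bool; true; false; if_then_else_; _∧_; _∨_; not; T)
import Data.Bool.Properties as BoolP
open import Algebra.Bundles using (CommutativeMonoid)
open import Algebra.Properties.CommutativeSemigroup (CommutativeMonoid.commutativeSemigroup BoolP.∧-commutativeMonoid)
  using () renaming (interchange to ∧-interchange)
open import Algebra.Lattice.Properties.BooleanAlgebra BoolP.∨-∧-booleanAlgebra using (deMorgan₂)
open import Data.Fin using (Fin; zero; suc)
import Data.Fin as Fin
open import Data.Fin.Subset using (_∪_; ⁅_⁆; ⋃) renaming (⊥ to ∅; ⊤ to full)
import Data.Fin.Subset.Properties as SubsetP
open import Data.Vec using ([]; _∷_; lookup; tabulate)
import Data.Vec.Properties as VecP
open import Data.List using ([]; _∷_; _++_; map; length; allFin; filterᵇ)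
import Data.List.Properties as ListP
open import Data.List.Relation.Unary.All as All using (All; []; _∷_)
import Data.List.Relation.Unary.All.Properties as AllP
open import Data.List.Relation.Unary.AllPairs using ([]; _∷_)
open import Data.List.Relation.Unary.Any using (here; there)
open import Data.List.Membership.Propositional using (_∈_)
import Data.List.Membership.Propositional.Properties as MembershipP
import Data.List.Relation.Unary.Unique.Propositional as Unique
import Data.List.Relation.Unary.Unique.Propositional.Properties as UniqueP
open import Data.Product using (∃; _×_; _,_; proj₁; proj₂)
open import Data.Unit using (tt)
open import Function using (_∘_; id; Equivalence)
open import Relation.Nullary using (¬_; Dec; yes; no; contradiction)
open import Relation.Nullary.Decidable using (⌊_⌋; isYes≗does; dec-true; dec-false; T?; toWitness)
open import Relation.Binary.PropositionalEquality
  using (_≢_; refl; sym; trans; cong; cong₂; subst; module ≡-Reasoning)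

open ≡-Reasoning

private
  variable
    n : ℕ

⟦_⟧ : Bool → ℤ
⟦ true ⟧ = 1ℤ
⟦ false ⟧ = 0ℤ

⟦∧⟧ : ∀ a b → ⟦ a ∧ b ⟧ ≡ ⟦ a ⟧ * ⟦ b ⟧
⟦∧⟧ true b = sym (ℤP.*-identityˡ ⟦ b ⟧)
⟦∧⟧ false b = refl

if-then-0 : ∀ b x → (if b then x else 0ℤ) ≡ ⟦ b ⟧ * x
if-then-0 true x = sym (ℤP.*-identityˡ x)
if-then-0 false x = refl

∑ : {X : Set} → List X → (X → ℤ) → ℤ
∑ xs f = sumℤ (map f xs)

syntax ∑ xs (λ x → e) = ∑[ x ∈ xs ] e

module _ {X : Set} where

  ∑-++ : ∀ xs ys (f : X → ℤ) → ∑ (xs ++ ys) f ≡ ∑ xs f + ∑ ys f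
  ∑-++ [] ys f = sym (ℤP.+-identityˡ _)
  ∑-++ (x ∷ xs) ys f = trans (cong (_+_ (f x)) (∑-++ xs ys f)) (sym (ℤP.+-assoc (f x) _ _))

  ∑-cong : ∀ xs {f g : X → ℤ} → (∀ x → f x ≡ g x) → ∑ xs f ≡ ∑ xs g
  ∑-cong [] f≡g = refl
  ∑-cong (x ∷ xs) f≡g = cong₂ _+_ (f≡g x) (∑-cong xs f≡g)

  ∑-congᴬ : ∀ {P : X → Set} {xs} {f g : X → ℤ} → All P xs → (∀ {x} → P x → f x ≡ g x) → ∑ xs f ≡ ∑ xs g
  ∑-congᴬ [] f≡g = refl
  ∑-congᴬ (px ∷ pxs) f≡g = cong₂ _+_ (f≡g px) (∑-congᴬ pxs f≡g)

  ∑-0 : (xs : List X) → ∑[ x ∈ xs ] 0ℤ ≡ 0ℤ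
  ∑-0 [] = refl
  ∑-0 (x ∷ xs) = trans (ℤP.+-identityˡ _) (∑-0 xs)

  ∑-+ : ∀ xs (f g : X → ℤ) → ∑[ x ∈ xs ] (f x + g x) ≡ ∑ xs f + ∑ xs g
  ∑-+ [] f g = refl
  ∑-+ (x ∷ xs) f g = trans (cong (_+_ (f x + g x)) (∑-+ xs f g)) (+-interchange (f x) (g x) _ _)

  ∑-*ˡ : ∀ xs c (f : X → ℤ) → ∑[ x ∈ xs ] (c * f x) ≡ c * ∑ xs f
  ∑-*ˡ [] c f = sym (ℤP.*-zeroʳ c)
  ∑-*ˡ (x ∷ xs) c f = trans (cong (_+_ (c * f x)) (∑-*ˡ xs c f)) (sym (ℤP.*-distribˡ-+ c (f x) _))

  ∑-*ʳ : ∀ xs c (f : X → ℤ) → ∑[ x ∈ xs ] (f x * c) ≡ ∑ xs f * c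
  ∑-*ʳ xs c f = trans (∑-cong xs (λ x → ℤP.*-comm (f x) c)) (trans (∑-*ˡ xs c f) (ℤP.*-comm c _))

  filterᵇ-accept : ∀ (p : X → Bool) {x} xs → p x ≡ true → filterᵇ p (x ∷ xs) ≡ x ∷ filterᵇ p xs
  filterᵇ-accept p xs px = ListP.filter-accept (T? ∘ p) (subst T (sym px) _)

  filterᵇ-reject : ∀ (p : X → Bool) {x} xs → p x ≡ false → filterᵇ p (x ∷ xs) ≡ filterᵇ p xs
  filterᵇ-reject p xs px = ListP.filter-reject (T? ∘ p) (subst T px)

  ∑-filter : ∀ p xs (f : X → ℤ) → ∑ (filterᵇ p xs) f ≡ ∑[ x ∈ xs ] (⟦ p x ⟧ * f x)
  ∑-filter p [] f = refl
  ∑-filter p (x ∷ xs) f = by-cases (p x) refl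
    where
    -- A plain `with p x` would also abstract the p x hidden inside filter's own with-clause.
    by-cases : ∀ b → p x ≡ b → ∑ (filterᵇ p (x ∷ xs)) f ≡ ∑[ y ∈ x ∷ xs ] (⟦ p y ⟧ * f y)
    by-cases true px rewrite filterᵇ-accept p xs px | px =
      cong₂ _+_ (sym (ℤP.*-identityˡ (f x))) (∑-filter p xs f)
    by-cases false px rewrite filterᵇ-reject p xs px | px =
      trans (∑-filter p xs f) (sym (ℤP.+-identityˡ _))

module _ {X Y : Set} where

  ∑-swap : (xs : List X) (ys : List Y) (f : X → Y → ℤ) →
    ∑[ x ∈ xs ] ∑ ys (f x) ≡ ∑[ y ∈ ys ] ∑[ x ∈ xs ] f x y
  ∑-swap [] ys f = sym (∑-0 ys)
  ∑-swap (x ∷ xs) ys f = trans (cong (_+_ (∑ ys (f x))) (∑-swap xs ys f)) (sym (∑-+ ys (f x) _))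

  ∑-exchange : (xs : List X) (ys : List Y) (a : X → ℤ) (b : Y → ℤ) (v : X → Y → ℤ) →
    ∑[ x ∈ xs ] (a x * ∑[ y ∈ ys ] (b y * v x y)) ≡ ∑[ y ∈ ys ] (b y * ∑[ x ∈ xs ] (a x * v x y))
  ∑-exchange xs ys a b v = begin
    ∑[ x ∈ xs ] (a x * ∑[ y ∈ ys ] (b y * v x y))
      ≡⟨ ∑-cong xs (λ x → sym (∑-*ˡ ys (a x) _)) ⟩
    ∑[ x ∈ xs ] ∑[ y ∈ ys ] (a x * (b y * v x y))
      ≡⟨ ∑-swap xs ys _ ⟩
    ∑[ y ∈ ys ] ∑[ x ∈ xs ] (a x * (b y * v x y))
      ≡⟨ ∑-cong ys (λ y → ∑-cong xs (λ x → x∙yz≈y∙xz (a x) (b y) _)) ⟩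
    ∑[ y ∈ ys ] ∑[ x ∈ xs ] (b y * (a x * v x y))
      ≡⟨ ∑-cong ys (λ y → ∑-*ˡ xs (b y) _) ⟩
    ∑[ y ∈ ys ] (b y * ∑[ x ∈ xs ] (a x * v x y)) ∎

∑-map : {X Y : Set} (g : X → Y) (xs : List X) (f : Y → ℤ) → ∑ (map g xs) f ≡ ∑ xs (f ∘ g)
∑-map g [] f = refl
∑-map g (x ∷ xs) f = cong (_+_ (f (g x))) (∑-map g xs f)

∑-allFin-suc : (f : Fin (suc n) → ℤ) → ∑ (allFin (suc n)) f ≡ f zero + ∑ (allFin n) (f ∘ suc)
∑-allFin-suc {n} f = cong (_+_ (f zero)) (trans (cong (λ ks → ∑ ks f) (sym (ListP.map-tabulate id suc))) (∑-map suc (allFin n) f))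

∑-allFin-single : (f : Fin n → ℤ) (i : Fin n) → (∀ j → j ≢ i → f j ≡ 0ℤ) → ∑ (allFin n) f ≡ f i
∑-allFin-single {suc n} f zero others = begin
  ∑ (allFin (suc n)) f
    ≡⟨ ∑-allFin-suc f ⟩
  f zero + ∑ (allFin n) (f ∘ suc)
    ≡⟨ cong (_+_ (f zero)) (trans (∑-cong (allFin n) (λ j → others (suc j) λ ())) (∑-0 (allFin n))) ⟩
  f zero + 0ℤ
    ≡⟨ ℤP.+-identityʳ (f zero) ⟩
  f zero ∎
∑-allFin-single {suc n} f (suc i) others = begin
  ∑ (allFin (suc n)) f
    ≡⟨ ∑-allFin-suc f ⟩
  f zero + ∑ (allFin n) (f ∘ suc)
    ≡⟨ cong₂ _+_ (others zero λ ())
                 (∑-allFin-single (f ∘ suc) i (λ j j≢i → others (suc j) λ { refl → j≢i refl })) ⟩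
  0ℤ + f (suc i)
    ≡⟨ ℤP.+-identityˡ (f (suc i)) ⟩
  f (suc i) ∎

-- Sublists and antichain weights

module _ {X : Set} where

  ∑-sublists-∷ : ∀ x xs (f : List X → ℤ) →
    ∑ (sublists (x ∷ xs)) f ≡ ∑ (sublists xs) f + ∑[ a ∈ sublists xs ] f (x ∷ a)
  ∑-sublists-∷ x xs f =
    trans (∑-++ (sublists xs) _ f) (cong (_+_ (∑ (sublists xs) f)) (∑-map (x ∷_) (sublists xs) f))

  ∑-sublists-filter : ∀ p xs (f : List X → ℤ) →
    ∑ (sublists (filterᵇ p xs)) f ≡ ∑[ a ∈ sublists xs ] (⟦ allᵇ p a ⟧ * f a)
  ∑-sublists-filter p [] f = cong (λ z → z + 0ℤ) (sym (ℤP.*-identityˡ (f [])))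
  ∑-sublists-filter p (x ∷ xs) f = by-cases (p x) refl
    where
    with-x : ∀ b → p x ≡ b →
      ∑[ a ∈ sublists xs ] (⟦ allᵇ p (x ∷ a) ⟧ * f (x ∷ a)) ≡ ∑[ a ∈ sublists xs ] (⟦ b ∧ allᵇ p a ⟧ * f (x ∷ a))
    with-x b px = ∑-cong (sublists xs) (λ a → cong (λ b → ⟦ b ∧ allᵇ p a ⟧ * f (x ∷ a)) px)

    by-cases : ∀ b → p x ≡ b →
      ∑ (sublists (filterᵇ p (x ∷ xs))) f ≡ ∑[ a ∈ sublists (x ∷ xs) ] (⟦ allᵇ p a ⟧ * f a)
    by-cases true px rewrite filterᵇ-accept p xs px = begin
      ∑ (sublists (x ∷ filterᵇ p xs)) f
        ≡⟨ ∑-sublists-∷ x (filterᵇ p xs) f ⟩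
      ∑ (sublists (filterᵇ p xs)) f + ∑[ a ∈ sublists (filterᵇ p xs) ] f (x ∷ a)
        ≡⟨ cong₂ _+_ (∑-sublists-filter p xs f) (trans (∑-sublists-filter p xs (f ∘ (x ∷_))) (sym (with-x true px))) ⟩
      (∑[ a ∈ sublists xs ] (⟦ allᵇ p a ⟧ * f a)) + ∑[ a ∈ sublists xs ] (⟦ allᵇ p (x ∷ a) ⟧ * f (x ∷ a))
        ≡⟨ sym (∑-sublists-∷ x xs _) ⟩
      ∑[ a ∈ sublists (x ∷ xs) ] (⟦ allᵇ p a ⟧ * f a) ∎
    by-cases false px rewrite filterᵇ-reject p xs px = begin
      ∑ (sublists (filterᵇ p xs)) f
        ≡⟨ trans (∑-sublists-filter p xs f) (sym (ℤP.+-identityʳ _)) ⟩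
      (∑[ a ∈ sublists xs ] (⟦ allᵇ p a ⟧ * f a)) + 0ℤ
        ≡⟨ cong (_+_ (∑[ a ∈ sublists xs ] (⟦ allᵇ p a ⟧ * f a))) (sym (trans (with-x false px) (∑-0 (sublists xs)))) ⟩
      (∑[ a ∈ sublists xs ] (⟦ allᵇ p a ⟧ * f a)) + ∑[ a ∈ sublists xs ] (⟦ allᵇ p (x ∷ a) ⟧ * f (x ∷ a))
        ≡⟨ sym (∑-sublists-∷ x xs _) ⟩
      ∑[ a ∈ sublists (x ∷ xs) ] (⟦ allᵇ p a ⟧ * f a) ∎

  ∑-sublists-partition : ∀ p xs (F : List X → List X → ℤ) →
    ∑[ s ∈ sublists xs ] F (filterᵇ p s) (filterᵇ (not ∘ p) s) ≡
    ∑[ a ∈ sublists (filterᵇ p xs) ] ∑[ b ∈ sublists (filterᵇ (not ∘ p) xs) ] F a b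
  ∑-sublists-partition p [] F = sym (ℤP.+-identityʳ _)
  ∑-sublists-partition p (x ∷ xs) F = by-cases (p x) refl
    where
    by-cases : ∀ b → p x ≡ b →
      ∑[ s ∈ sublists (x ∷ xs) ] F (filterᵇ p s) (filterᵇ (not ∘ p) s) ≡
      ∑[ a ∈ sublists (filterᵇ p (x ∷ xs)) ] ∑[ b ∈ sublists (filterᵇ (not ∘ p) (x ∷ xs)) ] F a b
    by-cases true px
      rewrite filterᵇ-accept p xs px | filterᵇ-reject (not ∘ p) xs (cong not px) = begin
      ∑[ s ∈ sublists (x ∷ xs) ] F (filterᵇ p s) (filterᵇ (not ∘ p) s)
        ≡⟨ ∑-sublists-∷ x xs _ ⟩
      (∑[ s ∈ sublists xs ] F (filterᵇ p s) (filterᵇ (not ∘ p) s))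
        + ∑[ s ∈ sublists xs ] F (filterᵇ p (x ∷ s)) (filterᵇ (not ∘ p) (x ∷ s))
        ≡⟨ cong₂ _+_ (∑-sublists-partition p xs F)
             (trans (∑-cong (sublists xs) λ s →
                       cong₂ F (filterᵇ-accept p s px) (filterᵇ-reject (not ∘ p) s (cong not px)))
                    (∑-sublists-partition p xs (F ∘ (x ∷_)))) ⟩
      (∑[ a ∈ sublists (filterᵇ p xs) ] ∑[ b ∈ sublists (filterᵇ (not ∘ p) xs) ] F a b)
        + ∑[ a ∈ sublists (filterᵇ p xs) ] ∑[ b ∈ sublists (filterᵇ (not ∘ p) xs) ] F (x ∷ a) b
        ≡⟨ sym (∑-sublists-∷ x (filterᵇ p xs) _) ⟩
      ∑[ a ∈ sublists (x ∷ filterᵇ p xs) ] ∑[ b ∈ sublists (filterᵇ (not ∘ p) xs) ] F a b ∎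
    by-cases false px
      rewrite filterᵇ-reject p xs px | filterᵇ-accept (not ∘ p) xs (cong not px) = begin
      ∑[ s ∈ sublists (x ∷ xs) ] F (filterᵇ p s) (filterᵇ (not ∘ p) s)
        ≡⟨ ∑-sublists-∷ x xs _ ⟩
      (∑[ s ∈ sublists xs ] F (filterᵇ p s) (filterᵇ (not ∘ p) s))
        + ∑[ s ∈ sublists xs ] F (filterᵇ p (x ∷ s)) (filterᵇ (not ∘ p) (x ∷ s))
        ≡⟨ cong₂ _+_ (∑-sublists-partition p xs F)
             (trans (∑-cong (sublists xs) λ s →
                       cong₂ F (filterᵇ-reject p s px) (filterᵇ-accept (not ∘ p) s (cong not px)))
                    (∑-sublists-partition p xs (λ a b → F a (x ∷ b)))) ⟩
      (∑[ a ∈ sublists (filterᵇ p xs) ] ∑[ b ∈ sublists (filterᵇ (not ∘ p) xs) ] F a b)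
        + ∑[ a ∈ sublists (filterᵇ p xs) ] ∑[ b ∈ sublists (filterᵇ (not ∘ p) xs) ] F a (x ∷ b)
        ≡⟨ sym (∑-+ (sublists (filterᵇ p xs)) _ _) ⟩
      ∑[ a ∈ sublists (filterᵇ p xs) ] ((∑[ b ∈ sublists (filterᵇ (not ∘ p) xs) ] F a b)
                                        + ∑[ b ∈ sublists (filterᵇ (not ∘ p) xs) ] F a (x ∷ b))
        ≡⟨ ∑-cong (sublists (filterᵇ p xs)) (λ a → sym (∑-sublists-∷ x (filterᵇ (not ∘ p) xs) (F a))) ⟩
      ∑[ a ∈ sublists (filterᵇ p xs) ] ∑[ b ∈ sublists (x ∷ filterᵇ (not ∘ p) xs) ] F a b ∎

  All-sublists : ∀ {P : X → Set} {xs} → All P xs → All (All P) (sublists xs)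
  All-sublists [] = [] ∷ []
  All-sublists (px ∷ pxs) =
    AllP.++⁺ (All-sublists pxs) (AllP.map⁺ (All.map (px ∷_) (All-sublists pxs)))

∑-sublists-map : {X Y : Set} (g : X → Y) (xs : List X) (f : List Y → ℤ) →
  ∑ (sublists (map g xs)) f ≡ ∑[ a ∈ sublists xs ] f (map g a)
∑-sublists-map g [] f = refl
∑-sublists-map g (x ∷ xs) f = begin
  ∑ (sublists (g x ∷ map g xs)) f
    ≡⟨ ∑-sublists-∷ (g x) (map g xs) f ⟩
  ∑ (sublists (map g xs)) f + ∑[ b ∈ sublists (map g xs) ] f (g x ∷ b)
    ≡⟨ cong₂ _+_ (∑-sublists-map g xs f) (∑-sublists-map g xs (f ∘ (g x ∷_))) ⟩
  (∑[ a ∈ sublists xs ] f (map g a)) + ∑[ a ∈ sublists xs ] f (map g (x ∷ a))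
    ≡⟨ sym (∑-sublists-∷ x xs (f ∘ map g)) ⟩
  ∑[ a ∈ sublists (x ∷ xs) ] f (map g a) ∎

module _ {X : Set} where

  ⟦allᵇ⟧-partition : ∀ (p r : X → Bool) s →
    ⟦ allᵇ r s ⟧ ≡ ⟦ allᵇ r (filterᵇ p s) ⟧ * ⟦ allᵇ r (filterᵇ (not ∘ p) s) ⟧
  ⟦allᵇ⟧-partition p r [] = refl
  ⟦allᵇ⟧-partition p r (x ∷ s) = by-cases (p x) refl
    where
    step : ⟦ allᵇ r (x ∷ s) ⟧ ≡ ⟦ r x ⟧ * (⟦ allᵇ r (filterᵇ p s) ⟧ * ⟦ allᵇ r (filterᵇ (not ∘ p) s) ⟧)
    step = trans (⟦∧⟧ (r x) _) (cong (⟦ r x ⟧ *_) (⟦allᵇ⟧-partition p r s))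

    by-cases : ∀ b → p x ≡ b →
      ⟦ allᵇ r (x ∷ s) ⟧ ≡ ⟦ allᵇ r (filterᵇ p (x ∷ s)) ⟧ * ⟦ allᵇ r (filterᵇ (not ∘ p) (x ∷ s)) ⟧
    by-cases true px
      rewrite filterᵇ-accept p s px | filterᵇ-reject (not ∘ p) s (cong not px)
            | ⟦∧⟧ (r x) (allᵇ r (filterᵇ p s)) =
      trans step (sym (ℤP.*-assoc ⟦ r x ⟧ ⟦ allᵇ r (filterᵇ p s) ⟧ _))
    by-cases false px
      rewrite filterᵇ-reject p s px | filterᵇ-accept (not ∘ p) s (cong not px)
            | ⟦∧⟧ (r x) (allᵇ r (filterᵇ (not ∘ p) s)) =
      trans step (x∙yz≈y∙xz ⟦ r x ⟧ ⟦ allᵇ r (filterᵇ p s) ⟧ _)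

  length-partition : ∀ (p : X → Bool) s → length s ≡ length (filterᵇ p s) ℕ.+ length (filterᵇ (not ∘ p) s)
  length-partition p [] = refl
  length-partition p (x ∷ s) = by-cases (p x) refl
    where
    by-cases : ∀ b → p x ≡ b → length (x ∷ s) ≡ length (filterᵇ p (x ∷ s)) ℕ.+ length (filterᵇ (not ∘ p) (x ∷ s))
    by-cases true px rewrite filterᵇ-accept p s px | filterᵇ-reject (not ∘ p) s (cong not px) =
      cong suc (length-partition p s)
    by-cases false px rewrite filterᵇ-reject p s px | filterᵇ-accept (not ∘ p) s (cong not px) =
      trans (cong suc (length-partition p s)) (sym (ℕP.+-suc _ _))

module _ {X : Set} (c : X → X → Bool) where

  crossIncomparable : List X → List X → Bool
  crossIncomparable a b = allᵇ (λ x → allᵇ (λ y → not (c x y)) b) a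

  weight : ℤ → List X → ℤ
  weight q a = ⟦ pairwiseIncomparable c a ⟧ * q ^ length a

  antichainGF-∑ : ∀ xs q → antichainGF c xs q ≡ ∑ (sublists xs) (weight q)
  antichainGF-∑ xs q = ∑-filter (pairwiseIncomparable c) (sublists xs) (λ s → q ^ length s)

  module _ (c-sym : ∀ x y → c x y ≡ c y x) where

    ⟦crossIncomparable⟧-∷ʳ : ∀ x a b →
      ⟦ crossIncomparable a (x ∷ b) ⟧ ≡ ⟦ allᵇ (λ y → not (c x y)) a ⟧ * ⟦ crossIncomparable a b ⟧
    ⟦crossIncomparable⟧-∷ʳ x [] b = refl
    ⟦crossIncomparable⟧-∷ʳ x (y ∷ a) b = begin
      ⟦ (not (c y x) ∧ B) ∧ crossIncomparable a (x ∷ b) ⟧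
        ≡⟨ trans (⟦∧⟧ (not (c y x) ∧ B) _) (cong₂ _*_ (⟦∧⟧ (not (c y x)) B) (⟦crossIncomparable⟧-∷ʳ x a b)) ⟩
      (⟦ not (c y x) ⟧ * ⟦ B ⟧) * (⟦ A ⟧ * ⟦ C ⟧)
        ≡⟨ cong (λ b → (⟦ not b ⟧ * ⟦ B ⟧) * (⟦ A ⟧ * ⟦ C ⟧)) (c-sym y x) ⟩
      (⟦ not (c x y) ⟧ * ⟦ B ⟧) * (⟦ A ⟧ * ⟦ C ⟧)
        ≡⟨ *-interchange ⟦ not (c x y) ⟧ ⟦ B ⟧ ⟦ A ⟧ ⟦ C ⟧ ⟩
      (⟦ not (c x y) ⟧ * ⟦ A ⟧) * (⟦ B ⟧ * ⟦ C ⟧)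
        ≡⟨ sym (cong₂ _*_ (⟦∧⟧ (not (c x y)) A) (⟦∧⟧ B C)) ⟩
      ⟦ not (c x y) ∧ A ⟧ * ⟦ B ∧ C ⟧ ∎
      where
      A B C : Bool
      A = allᵇ (λ z → not (c x z)) a
      B = allᵇ (λ z → not (c y z)) b
      C = crossIncomparable a b

    ⟦pairwiseIncomparable⟧-partition : ∀ p s →
      ⟦ pairwiseIncomparable c s ⟧ ≡
        ⟦ pairwiseIncomparable c (filterᵇ p s) ⟧ * ⟦ pairwiseIncomparable c (filterᵇ (not ∘ p) s) ⟧
          * ⟦ crossIncomparable (filterᵇ p s) (filterᵇ (not ∘ p) s) ⟧
    ⟦pairwiseIncomparable⟧-partition p [] = refl
    ⟦pairwiseIncomparable⟧-partition p (x ∷ s) = by-cases (p x) refl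
      where
      s₁ s₂ : List X
      s₁ = filterᵇ p s
      s₂ = filterᵇ (not ∘ p) s
      below-x : List X → Bool
      below-x = allᵇ (λ y → not (c x y))
      A₁ A₂ P₁ P₂ K : ℤ
      A₁ = ⟦ below-x s₁ ⟧
      A₂ = ⟦ below-x s₂ ⟧
      P₁ = ⟦ pairwiseIncomparable c s₁ ⟧
      P₂ = ⟦ pairwiseIncomparable c s₂ ⟧
      K = ⟦ crossIncomparable s₁ s₂ ⟧

      expand : ⟦ pairwiseIncomparable c (x ∷ s) ⟧ ≡ (A₁ * A₂) * (P₁ * P₂ * K)
      expand = trans (⟦∧⟧ (below-x s) (pairwiseIncomparable c s))
        (cong₂ _*_ (⟦allᵇ⟧-partition p (λ y → not (c x y)) s) (⟦pairwiseIncomparable⟧-partition p s))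

      x-in-s₁ : ∀ a₁ a₂ p₁ p₂ k → (a₁ * a₂) * (p₁ * p₂ * k) ≡ (a₁ * p₁) * p₂ * (a₂ * k)
      x-in-s₁ = solve-∀

      x-in-s₂ : ∀ a₁ a₂ p₁ p₂ k → (a₁ * a₂) * (p₁ * p₂ * k) ≡ p₁ * (a₂ * p₂) * (a₁ * k)
      x-in-s₂ = solve-∀

      by-cases : ∀ b → p x ≡ b →
        ⟦ pairwiseIncomparable c (x ∷ s) ⟧ ≡
          ⟦ pairwiseIncomparable c (filterᵇ p (x ∷ s)) ⟧ * ⟦ pairwiseIncomparable c (filterᵇ (not ∘ p) (x ∷ s)) ⟧
            * ⟦ crossIncomparable (filterᵇ p (x ∷ s)) (filterᵇ (not ∘ p) (x ∷ s)) ⟧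
      by-cases true px rewrite filterᵇ-accept p s px | filterᵇ-reject (not ∘ p) s (cong not px) =
        trans expand (trans (x-in-s₁ A₁ A₂ P₁ P₂ K)
          (sym (cong₂ _*_ (cong (_* P₂) (⟦∧⟧ (below-x s₁) (pairwiseIncomparable c s₁)))
                          (⟦∧⟧ (below-x s₂) (crossIncomparable s₁ s₂)))))
      by-cases false px rewrite filterᵇ-reject p s px | filterᵇ-accept (not ∘ p) s (cong not px) =
        trans expand (trans (x-in-s₂ A₁ A₂ P₁ P₂ K)
          (sym (cong₂ _*_ (cong (P₁ *_) (⟦∧⟧ (below-x s₂) (pairwiseIncomparable c s₂)))
                          (⟦crossIncomparable⟧-∷ʳ x s₁ s₂))))

    weight-partition : ∀ q p s →
      weight q s ≡
        weight q (filterᵇ p s) * weight q (filterᵇ (not ∘ p) s) * ⟦ crossIncomparable (filterᵇ p s) (filterᵇ (not ∘ p) s) ⟧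
    weight-partition q p s = begin
      ⟦ pairwiseIncomparable c s ⟧ * q ^ length s
        ≡⟨ cong₂ _*_ (⟦pairwiseIncomparable⟧-partition p s)
                     (trans (cong (q ^_) (length-partition p s)) (ℤP.^-distribˡ-+-* q (length s₁) (length s₂))) ⟩
      ⟦ pairwiseIncomparable c s₁ ⟧ * ⟦ pairwiseIncomparable c s₂ ⟧ * ⟦ crossIncomparable s₁ s₂ ⟧
        * (q ^ length s₁ * q ^ length s₂)
        ≡⟨ rearrange ⟦ pairwiseIncomparable c s₁ ⟧ ⟦ pairwiseIncomparable c s₂ ⟧ ⟦ crossIncomparable s₁ s₂ ⟧
                     (q ^ length s₁) (q ^ length s₂) ⟩
      weight q s₁ * weight q s₂ * ⟦ crossIncomparable s₁ s₂ ⟧ ∎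
      where
      s₁ s₂ : List X
      s₁ = filterᵇ p s
      s₂ = filterᵇ (not ∘ p) s
      rearrange : ∀ p₁ p₂ k m₁ m₂ → p₁ * p₂ * k * (m₁ * m₂) ≡ p₁ * m₁ * (p₂ * m₂) * k
      rearrange = solve-∀

    ∑-antichains-partition : ∀ q p xs (F : List X → List X → ℤ) →
      ∑[ s ∈ sublists xs ] (weight q s * F (filterᵇ p s) (filterᵇ (not ∘ p) s)) ≡
      ∑[ a ∈ sublists (filterᵇ p xs) ] ∑[ b ∈ sublists (filterᵇ (not ∘ p) xs) ]
        (weight q a * weight q b * ⟦ crossIncomparable a b ⟧ * F a b)
    ∑-antichains-partition q p xs F =
      trans (∑-cong (sublists xs) (λ s → cong (_* F (filterᵇ p s) (filterᵇ (not ∘ p) s)) (weight-partition q p s)))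
            (∑-sublists-partition p xs (λ a b → weight q a * weight q b * ⟦ crossIncomparable a b ⟧ * F a b))

allᵇ-map : {X Y : Set} (g : X → Y) (r : Y → Bool) (xs : List X) → allᵇ r (map g xs) ≡ allᵇ (r ∘ g) xs
allᵇ-map g r [] = refl
allᵇ-map g r (x ∷ xs) = cong (r (g x) ∧_) (allᵇ-map g r xs)

module _ {X Y : Set} (g : X → Y) where

  pairwiseIncomparable-map : ∀ (c : Y → Y → Bool) xs →
    pairwiseIncomparable c (map g xs) ≡ pairwiseIncomparable (λ x y → c (g x) (g y)) xs
  pairwiseIncomparable-map c [] = refl
  pairwiseIncomparable-map c (x ∷ xs) =
    cong₂ _∧_ (allᵇ-map g (λ y → not (c (g x) y)) xs) (pairwiseIncomparable-map c xs)

  crossIncomparable-map : ∀ (h : X → Y) (c : Y → Y → Bool) a b →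
    crossIncomparable c (map g a) (map h b) ≡ crossIncomparable (λ x y → c (g x) (h y)) a b
  crossIncomparable-map h c [] b = refl
  crossIncomparable-map h c (x ∷ a) b =
    cong₂ _∧_ (allᵇ-map h (λ y → not (c (g x) y)) b) (crossIncomparable-map h c a b)

  weight-map : ∀ (c : Y → Y → Bool) q a → weight c q (map g a) ≡ weight (λ x y → c (g x) (g y)) q a
  weight-map c q a = cong₂ (λ b l → ⟦ b ⟧ * q ^ l) (pairwiseIncomparable-map c a) (ListP.length-map g a)

allᵇ-allFin-suc : (p : Fin (suc n) → Bool) → allᵇ p (allFin (suc n)) ≡ p zero ∧ allᵇ (p ∘ suc) (allFin n)
allᵇ-allFin-suc {n} p = cong (p zero ∧_) (trans (cong (allᵇ p) (sym (ListP.map-tabulate id suc))) (allᵇ-map suc p (allFin n)))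

module _ {X : Set} where

  anyᵇ≡not-allᵇ : ∀ (p : X → Bool) xs → anyᵇ p xs ≡ not (allᵇ (not ∘ p) xs)
  anyᵇ≡not-allᵇ p [] = refl
  anyᵇ≡not-allᵇ p (x ∷ xs) with p x
  ... | true = refl
  ... | false = anyᵇ≡not-allᵇ p xs

  allᵇ-cong : ∀ {p r : X → Bool} xs → (∀ x → p x ≡ r x) → allᵇ p xs ≡ allᵇ r xs
  allᵇ-cong [] p≡r = refl
  allᵇ-cong (x ∷ xs) p≡r = cong₂ _∧_ (p≡r x) (allᵇ-cong xs p≡r)

  allᵇ-intro : ∀ {p : X → Bool} xs → (∀ x → p x ≡ true) → allᵇ p xs ≡ true
  allᵇ-intro [] px = refl
  allᵇ-intro {p} (x ∷ xs) px rewrite px x = allᵇ-intro xs px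

  allᵇ-elim : ∀ {p : X → Bool} {x} xs → allᵇ p xs ≡ true → x ∈ xs → p x ≡ true
  allᵇ-elim {p} (y ∷ xs) all-p (here refl) with p y
  ... | true = refl
  allᵇ-elim {p} (y ∷ xs) all-p (there x∈xs) with p y
  ... | true = allᵇ-elim xs all-p x∈xs

  allᵇ-reject : ∀ {p : X → Bool} {x} xs → x ∈ xs → p x ≡ false → allᵇ p xs ≡ false
  allᵇ-reject (y ∷ xs) (here refl) px rewrite px = refl
  allᵇ-reject {p} (y ∷ xs) (there x∈xs) px = trans (cong (p y ∧_) (allᵇ-reject xs x∈xs px)) (BoolP.∧-zeroʳ (p y))

  anyᵇ-elim : ∀ {p : X → Bool} xs → anyᵇ p xs ≡ true → ∃ λ x → p x ≡ true
  anyᵇ-elim {p} (x ∷ xs) any-p with p x in px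
  ... | true = x , px
  ... | false = anyᵇ-elim xs any-p

  anyᵇ-intro : ∀ {p : X → Bool} {x} xs → x ∈ xs → p x ≡ true → anyᵇ p xs ≡ true
  anyᵇ-intro (y ∷ xs) (here refl) px rewrite px = refl
  anyᵇ-intro {p} (y ∷ xs) (there x∈xs) px = trans (cong (p y ∨_) (anyᵇ-intro xs x∈xs px)) (BoolP.∨-zeroʳ (p y))

⌊⌋-true : {P : Set} (d : Dec P) → P → ⌊ d ⌋ ≡ true
⌊⌋-true d p = trans (isYes≗does d) (dec-true d p)

⌊⌋-false : {P : Set} (d : Dec P) → ¬ P → ⌊ d ⌋ ≡ false
⌊⌋-false d ¬p = trans (isYes≗does d) (dec-false d ¬p)

zipAllᵇ : (Bool → Bool → Bool) → Subset n → Subset n → Bool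
zipAllᵇ f [] [] = true
zipAllᵇ f (a ∷ A) (b ∷ B) = f a b ∧ zipAllᵇ f A B

allᵇ-lookup : ∀ f (A B : Subset n) → allᵇ (λ k → f (lookup A k) (lookup B k)) (allFin n) ≡ zipAllᵇ f A B
allᵇ-lookup f [] [] = refl
allᵇ-lookup f (a ∷ A) (b ∷ B) =
  trans (allᵇ-allFin-suc (λ k → f (lookup (a ∷ A) k) (lookup (b ∷ B) k))) (cong (f a b ∧_) (allᵇ-lookup f A B))

zipAllᵇ-∪ˡ : ∀ {f} → (∀ a b c → f (a ∨ b) c ≡ f a c ∧ f b c) →
  ∀ (A B C : Subset n) → zipAllᵇ f (A ∪ B) C ≡ zipAllᵇ f A C ∧ zipAllᵇ f B C
zipAllᵇ-∪ˡ f-∨ [] [] [] = refl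
zipAllᵇ-∪ˡ {f = f} f-∨ (a ∷ A) (b ∷ B) (c ∷ C) =
  trans (cong₂ _∧_ (f-∨ a b c) (zipAllᵇ-∪ˡ f-∨ A B C)) (∧-interchange (f a c) (f b c) (zipAllᵇ f A C) (zipAllᵇ f B C))

zipAllᵇ-comm : ∀ {f} → (∀ a b → f a b ≡ f b a) → ∀ (A B : Subset n) → zipAllᵇ f A B ≡ zipAllᵇ f B A
zipAllᵇ-comm f-comm [] [] = refl
zipAllᵇ-comm f-comm (a ∷ A) (b ∷ B) = cong₂ _∧_ (f-comm a b) (zipAllᵇ-comm f-comm A B)

zipAllᵇ-∅ˡ : ∀ {f} → (∀ b → f false b ≡ true) → ∀ (B : Subset n) → zipAllᵇ f ∅ B ≡ true
zipAllᵇ-∅ˡ f-false [] = refl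
zipAllᵇ-∅ˡ f-false (b ∷ B) = cong₂ _∧_ (f-false b) (zipAllᵇ-∅ˡ f-false B)

-- Structurally recursive forms of _⊆ᵇ_ and disjointᵇ, which are convenient for induction.

infix 4.5 _⊆ˢ_

_⊆ˢ_ : {n : ℕ} → Subset n → Subset n → Bool
_⊆ˢ_ = zipAllᵇ (λ a b → not a ∨ b)

disjointˢ : {n : ℕ} → Subset n → Subset n → Bool
disjointˢ = zipAllᵇ (λ a b → not (a ∧ b))

⊆ᵇ≡⊆ˢ : (A B : Subset n) → A ⊆ᵇ B ≡ A ⊆ˢ B
⊆ᵇ≡⊆ˢ = allᵇ-lookup _

disjointᵇ≡disjointˢ : (A B : Subset n) → disjointᵇ A B ≡ disjointˢ A B
disjointᵇ≡disjointˢ = allᵇ-lookup _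

∪-⊆ˢ : (A B C : Subset n) → A ∪ B ⊆ˢ C ≡ (A ⊆ˢ C) ∧ (B ⊆ˢ C)
∪-⊆ˢ = zipAllᵇ-∪ˡ λ a b c → trans (cong (_∨ c) (deMorgan₂ a b)) (BoolP.∨-distribʳ-∧ c (not a) (not b))

disjointˢ-∪ˡ : (A B C : Subset n) → disjointˢ (A ∪ B) C ≡ disjointˢ A C ∧ disjointˢ B C
disjointˢ-∪ˡ = zipAllᵇ-∪ˡ λ a b c → trans (cong not (BoolP.∧-distribʳ-∨ c a b)) (deMorgan₂ (a ∧ c) (b ∧ c))

disjointˢ-comm : (A B : Subset n) → disjointˢ A B ≡ disjointˢ B A
disjointˢ-comm = zipAllᵇ-comm λ a b → cong not (BoolP.∧-comm a b)

disjointˢ-∪ʳ : (A B C : Subset n) → disjointˢ A (B ∪ C) ≡ disjointˢ A B ∧ disjointˢ A C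
disjointˢ-∪ʳ A B C = trans (disjointˢ-comm A (B ∪ C))
  (trans (disjointˢ-∪ˡ B C A) (cong₂ _∧_ (disjointˢ-comm B A) (disjointˢ-comm C A)))

∅-⊆ˢ : (A : Subset n) → ∅ ⊆ˢ A ≡ true
∅-⊆ˢ = zipAllᵇ-∅ˡ λ _ → refl

∅-disjointˢ : (A : Subset n) → disjointˢ ∅ A ≡ true
∅-disjointˢ = zipAllᵇ-∅ˡ λ _ → refl

⊆ˢ-full : (A : Subset n) → A ⊆ˢ full ≡ true
⊆ˢ-full [] = refl
⊆ˢ-full (a ∷ A) = trans (cong (_∧ (A ⊆ˢ full)) (BoolP.∨-zeroʳ (not a))) (⊆ˢ-full A)

lookup-⁅⁆-self : (i : Fin n) → lookup ⁅ i ⁆ i ≡ true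
lookup-⁅⁆-self zero = refl
lookup-⁅⁆-self (suc i) = lookup-⁅⁆-self i

lookup-⁅⁆-other : {i k : Fin n} → k ≢ i → lookup ⁅ i ⁆ k ≡ false
lookup-⁅⁆-other {i = zero} {zero} k≢i = contradiction refl k≢i
lookup-⁅⁆-other {i = zero} {suc k} k≢i = VecP.lookup-replicate k false
lookup-⁅⁆-other {i = suc i} {zero} k≢i = refl
lookup-⁅⁆-other {i = suc i} {suc k} k≢i = lookup-⁅⁆-other (k≢i ∘ cong suc)

⁅⁆-disjointˢ : (i : Fin n) (A : Subset n) → disjointˢ ⁅ i ⁆ A ≡ not (lookup A i)
⁅⁆-disjointˢ zero (a ∷ A) = trans (cong (not a ∧_) (∅-disjointˢ A)) (BoolP.∧-identityʳ (not a))
⁅⁆-disjointˢ (suc i) (a ∷ A) = ⁅⁆-disjointˢ i A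

card-∅ : card (∅ {n}) ≡ 0
card-∅ {zero} = refl
card-∅ {suc n} = card-∅ {n}

card-mono : (K J : Subset n) → K ⊆ˢ J ≡ true → card K ℕ.≤ card J
card-mono [] [] K⊆J = ℕ.z≤n
card-mono (true ∷ K) (true ∷ J) K⊆J = ℕ.s≤s (card-mono K J K⊆J)
card-mono (false ∷ K) (true ∷ J) K⊆J = ℕP.m≤n⇒m≤1+n (card-mono K J K⊆J)
card-mono (false ∷ K) (false ∷ J) K⊆J = card-mono K J K⊆J

-- Sums over subsets and Kronecker powers

∑-subsets-∷ : (f : Subset (suc n) → ℤ) →
  ∑ (allSubsets (suc n)) f ≡ (∑[ M ∈ allSubsets n ] f (false ∷ M)) + ∑[ M ∈ allSubsets n ] f (true ∷ M)
∑-subsets-∷ {n} f =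
  trans (∑-++ (map (false ∷_) (allSubsets n)) _ f) (cong₂ _+_ (∑-map _ (allSubsets n) f) (∑-map _ (allSubsets n) f))

∑-subsets-factor : ∀ {f : Subset (suc n) → ℤ} {g : Subset n → ℤ} a b →
  (∀ M → f (false ∷ M) ≡ a * g M) → (∀ M → f (true ∷ M) ≡ b * g M) →
  ∑ (allSubsets (suc n)) f ≡ (a + b) * ∑ (allSubsets n) g
∑-subsets-factor {n} {f} {g} a b f-false f-true = begin
  ∑ (allSubsets (suc n)) f
    ≡⟨ ∑-subsets-∷ f ⟩
  (∑[ M ∈ allSubsets n ] f (false ∷ M)) + ∑[ M ∈ allSubsets n ] f (true ∷ M)
    ≡⟨ cong₂ _+_ (trans (∑-cong (allSubsets n) f-false) (∑-*ˡ (allSubsets n) a g))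
                 (trans (∑-cong (allSubsets n) f-true) (∑-*ˡ (allSubsets n) b g)) ⟩
  a * ∑ (allSubsets n) g + b * ∑ (allSubsets n) g
    ≡⟨ sym (ℤP.*-distribʳ-+ (∑ (allSubsets n) g) a b) ⟩
  (a + b) * ∑ (allSubsets n) g ∎

-- The (X , Y) entry of the n-th Kronecker power of the 2 × 2 matrix f.
kron : (Bool → Bool → ℤ) → Subset n → Subset n → ℤ
kron f [] [] = 1ℤ
kron f (x ∷ X) (y ∷ Y) = f x y * kron f X Y

_·₂_ : (Bool → Bool → ℤ) → (Bool → Bool → ℤ) → Bool → Bool → ℤ
(f ·₂ g) x z = f x false * g false z + f x true * g true z

kron-cong : ∀ {f g} → (∀ x y → f x y ≡ g x y) → (X Y : Subset n) → kron f X Y ≡ kron g X Y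
kron-cong f≡g [] [] = refl
kron-cong f≡g (x ∷ X) (y ∷ Y) = cong₂ _*_ (f≡g x y) (kron-cong f≡g X Y)

∑-kron-· : ∀ f g (X Z : Subset n) → ∑[ Y ∈ allSubsets n ] (kron f X Y * kron g Y Z) ≡ kron (f ·₂ g) X Z
∑-kron-· f g [] [] = refl
∑-kron-· f g (x ∷ X) (z ∷ Z) =
  trans (∑-subsets-factor (f x false * g false z) (f x true * g true z) (factor false) (factor true))
        (cong ((f ·₂ g) x z *_) (∑-kron-· f g X Z))
  where
  factor : ∀ y Y → (f x y * kron f X Y) * (g y z * kron g Y Z) ≡ (f x y * g y z) * (kron f X Y * kron g Y Z)
  factor y Y = *-interchange (f x y) (kron f X Y) (g y z) (kron g Y Z)

shear : ℤ → Bool → Bool → ℤ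
shear x true true = 1ℤ
shear x true false = x
shear x false true = 0ℤ
shear x false false = 1ℤ

shear-·₂ : ∀ x y a b → (shear x ·₂ shear y) a b ≡ shear (x + y) a b
shear-·₂ x y true true = cong (_+ 1ℤ) (ℤP.*-zeroʳ x)
shear-·₂ x y true false = cong₂ _+_ (ℤP.*-identityʳ x) (ℤP.*-identityˡ y)
shear-·₂ x y false true = refl
shear-·₂ x y false false = refl

∑-kron-shear : ∀ x y (X Z : Subset n) →
  ∑[ Y ∈ allSubsets n ] (kron (shear x) X Y * kron (shear y) Y Z) ≡ kron (shear (x + y)) X Z
∑-kron-shear x y X Z = trans (∑-kron-· (shear x) (shear y) X Z) (kron-cong (shear-·₂ x y) X Z)

kron-shear : ∀ x (J K : Subset n) → ⟦ K ⊆ˢ J ⟧ * x ^ (card J ∸ card K) ≡ kron (shear x) J K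
kron-shear x [] [] = refl
kron-shear x (true ∷ J) (true ∷ K) = trans (kron-shear x J K) (sym (ℤP.*-identityˡ _))
kron-shear x (false ∷ J) (false ∷ K) = trans (kron-shear x J K) (sym (ℤP.*-identityˡ _))
kron-shear x (false ∷ J) (true ∷ K) = refl
kron-shear x (true ∷ J) (false ∷ K) = by-cases (K ⊆ˢ J) refl
  where
  ih : ∀ {b} → K ⊆ˢ J ≡ b → ⟦ b ⟧ * x ^ (card J ∸ card K) ≡ kron (shear x) J K
  ih K⊆J = trans (cong (λ b → ⟦ b ⟧ * x ^ (card J ∸ card K)) (sym K⊆J)) (kron-shear x J K)

  by-cases : ∀ b → K ⊆ˢ J ≡ b → ⟦ b ⟧ * x ^ (suc (card J) ∸ card K) ≡ x * kron (shear x) J K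
  by-cases true K⊆J = begin
    1ℤ * x ^ (suc (card J) ∸ card K)   ≡⟨ trans (ℤP.*-identityˡ _) (cong (x ^_) (ℕP.+-∸-assoc 1 (card-mono K J K⊆J))) ⟩
    x * x ^ (card J ∸ card K)          ≡⟨ cong (x *_) (sym (ℤP.*-identityˡ _)) ⟩
    x * (1ℤ * x ^ (card J ∸ card K))   ≡⟨ cong (x *_) (ih K⊆J) ⟩
    x * kron (shear x) J K             ∎
  by-cases false K⊆J = sym (trans (cong (x *_) (sym (ih K⊆J))) (ℤP.*-zeroʳ x))

∑-shear-transform : ∀ x y (J : Subset n) (C G : Subset n → ℤ) →
  (∀ K → C K ≡ ∑[ T ∈ allSubsets n ] (G T * kron (shear y) K T)) →
  ∑[ K ∈ allSubsets n ] (⟦ K ⊆ᵇ J ⟧ * (x ^ (card J ∸ card K) * C K)) ≡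
  ∑[ T ∈ allSubsets n ] (G T * kron (shear (x + y)) J T)
∑-shear-transform {n} x y J C G C≡ = begin
  ∑[ K ∈ allSubsets n ] (⟦ K ⊆ᵇ J ⟧ * (x ^ (card J ∸ card K) * C K))
    ≡⟨ ∑-cong (allSubsets n) (λ K → trans (sym (ℤP.*-assoc ⟦ K ⊆ᵇ J ⟧ (x ^ (card J ∸ card K)) (C K)))
                                          (cong₂ _*_ (trans (cong (λ b → ⟦ b ⟧ * x ^ (card J ∸ card K)) (⊆ᵇ≡⊆ˢ K J))
                                                            (kron-shear x J K))
                                                     (C≡ K))) ⟩
  ∑[ K ∈ allSubsets n ] (kron (shear x) J K * ∑[ T ∈ allSubsets n ] (G T * kron (shear y) K T))
    ≡⟨ ∑-exchange (allSubsets n) (allSubsets n) (kron (shear x) J) G (λ K T → kron (shear y) K T) ⟩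
  ∑[ T ∈ allSubsets n ] (G T * ∑[ K ∈ allSubsets n ] (kron (shear x) J K * kron (shear y) K T))
    ≡⟨ ∑-cong (allSubsets n) (λ T → cong (G T *_) (∑-kron-shear x y J T)) ⟩
  ∑[ T ∈ allSubsets n ] (G T * kron (shear (x + y)) J T) ∎

δ : Subset n → Subset n → ℤ
δ = kron (shear 0ℤ)

∑-δ : (X : Subset n) (F : Subset n → ℤ) → ∑[ T ∈ allSubsets n ] (δ X T * F T) ≡ F X
∑-δ [] F = trans (ℤP.+-identityʳ _) (ℤP.*-identityˡ (F []))
∑-δ {suc n} (true ∷ X) F = begin
  ∑[ T ∈ allSubsets (suc n) ] (δ (true ∷ X) T * F T)
    ≡⟨ ∑-subsets-∷ (λ T → δ (true ∷ X) T * F T) ⟩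
  (∑[ T ∈ allSubsets n ] 0ℤ) + ∑[ T ∈ allSubsets n ] (1ℤ * δ X T * F (true ∷ T))
    ≡⟨ cong₂ _+_ (∑-0 (allSubsets n))
                 (∑-cong (allSubsets n) (λ T → cong (_* F (true ∷ T)) (ℤP.*-identityˡ (δ X T)))) ⟩
  0ℤ + ∑[ T ∈ allSubsets n ] (δ X T * F (true ∷ T))
    ≡⟨ trans (ℤP.+-identityˡ _) (∑-δ X (F ∘ (true ∷_))) ⟩
  F (true ∷ X) ∎
∑-δ {suc n} (false ∷ X) F = begin
  ∑[ T ∈ allSubsets (suc n) ] (δ (false ∷ X) T * F T)
    ≡⟨ ∑-subsets-∷ (λ T → δ (false ∷ X) T * F T) ⟩
  (∑[ T ∈ allSubsets n ] (1ℤ * δ X T * F (false ∷ T))) + ∑[ T ∈ allSubsets n ] 0ℤ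
    ≡⟨ cong₂ _+_ (∑-cong (allSubsets n) (λ T → cong (_* F (false ∷ T)) (ℤP.*-identityˡ (δ X T))))
                 (∑-0 (allSubsets n)) ⟩
  (∑[ T ∈ allSubsets n ] (δ X T * F (false ∷ T))) + 0ℤ
    ≡⟨ trans (ℤP.+-identityʳ _) (∑-δ X (F ∘ (false ∷_))) ⟩
  F (false ∷ X) ∎

∑-fibres : {X : Set} (xs : List X) (w : X → ℤ) (key : X → Subset n) (Φ : Subset n → ℤ) →
  ∑[ x ∈ xs ] (w x * Φ (key x)) ≡ ∑[ T ∈ allSubsets n ] (∑[ x ∈ xs ] (w x * δ (key x) T) * Φ T)
∑-fibres {n} xs w key Φ = begin
  ∑[ x ∈ xs ] (w x * Φ (key x))
    ≡⟨ ∑-cong xs (λ x → cong (w x *_) (sym (∑-δ (key x) Φ))) ⟩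
  ∑[ x ∈ xs ] (w x * ∑[ T ∈ allSubsets n ] (δ (key x) T * Φ T))
    ≡⟨ ∑-cong xs (λ x → sym (∑-*ˡ (allSubsets n) (w x) _)) ⟩
  ∑[ x ∈ xs ] ∑[ T ∈ allSubsets n ] (w x * (δ (key x) T * Φ T))
    ≡⟨ ∑-swap xs (allSubsets n) _ ⟩
  ∑[ T ∈ allSubsets n ] ∑[ x ∈ xs ] (w x * (δ (key x) T * Φ T))
    ≡⟨ ∑-cong (allSubsets n) (λ T → trans (∑-cong xs (λ x → sym (ℤP.*-assoc (w x) _ (Φ T))))
                                          (∑-*ʳ xs (Φ T) _)) ⟩
  ∑[ T ∈ allSubsets n ] (∑[ x ∈ xs ] (w x * δ (key x) T) * Φ T) ∎

∑-disjoint-union-⊆ : ∀ q (K T : Subset n) →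
  ∑[ M ∈ allSubsets n ] (q ^ card M * (⟦ disjointˢ M T ⟧ * ⟦ M ∪ T ⊆ˢ K ⟧)) ≡ kron (shear (1ℤ + q)) K T
∑-disjoint-union-⊆ q [] [] = refl
∑-disjoint-union-⊆ {suc n} q (k ∷ K) (t ∷ T) =
  trans (factor k t) (cong (shear (1ℤ + q) k t *_) (∑-disjoint-union-⊆ q K T))
  where
  g : Subset n → ℤ
  g M = q ^ card M * (⟦ disjointˢ M T ⟧ * ⟦ M ∪ T ⊆ˢ K ⟧)

  vanishes : ∀ c M → c * (⟦ disjointˢ M T ⟧ * 0ℤ) ≡ 0ℤ * g M
  vanishes c M = trans (cong (c *_) (ℤP.*-zeroʳ ⟦ disjointˢ M T ⟧)) (ℤP.*-zeroʳ c)

  factor : ∀ k t →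
    ∑[ M ∈ allSubsets (suc n) ] (q ^ card M * (⟦ disjointˢ M (t ∷ T) ⟧ * ⟦ M ∪ (t ∷ T) ⊆ˢ (k ∷ K) ⟧)) ≡
    shear (1ℤ + q) k t * ∑ (allSubsets n) g
  factor true true = ∑-subsets-factor {g = g} 1ℤ 0ℤ (λ M → sym (ℤP.*-identityˡ (g M))) (λ M → ℤP.*-zeroʳ (q * q ^ card M))
  factor true false = ∑-subsets-factor {g = g} 1ℤ q (λ M → sym (ℤP.*-identityˡ (g M))) (λ M → ℤP.*-assoc q (q ^ card M) _)
  factor false true = ∑-subsets-factor {g = g} 0ℤ 0ℤ (λ M → vanishes (q ^ card M) M) (λ M → ℤP.*-zeroʳ (q * q ^ card M))
  factor false false = ∑-subsets-factor {g = g} 1ℤ 0ℤ (λ M → sym (ℤP.*-identityˡ (g M))) (λ M → vanishes (q * q ^ card M) M)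

∑-⊆-∅ : (f : Subset n → ℤ) → ∑[ M ∈ allSubsets n ] (⟦ M ⊆ˢ ∅ ⟧ * f M) ≡ f ∅
∑-⊆-∅ {zero} f = trans (ℤP.+-identityʳ _) (ℤP.*-identityˡ (f []))
∑-⊆-∅ {suc n} f = begin
  ∑[ M ∈ allSubsets (suc n) ] (⟦ M ⊆ˢ ∅ ⟧ * f M)
    ≡⟨ ∑-subsets-∷ (λ M → ⟦ M ⊆ˢ ∅ ⟧ * f M) ⟩
  (∑[ M ∈ allSubsets n ] (⟦ M ⊆ˢ ∅ ⟧ * f (false ∷ M))) + ∑[ M ∈ allSubsets n ] 0ℤ
    ≡⟨ cong₂ _+_ (∑-⊆-∅ (f ∘ (false ∷_))) (∑-0 (allSubsets n)) ⟩
  f ∅ + 0ℤ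
    ≡⟨ ℤP.+-identityʳ (f ∅) ⟩
  f ∅ ∎

∑-⊆-insert : ∀ q (i : Fin n) (S : Subset n) → lookup S i ≡ false → (h : Subset n → ℤ) →
  ∑[ M ∈ allSubsets n ] (⟦ M ⊆ˢ ⁅ i ⁆ ∪ S ⟧ * (q ^ card M * h M)) ≡
  ∑[ M ∈ allSubsets n ] (⟦ M ⊆ˢ S ⟧ * (q ^ card M * (h M + q * h (⁅ i ⁆ ∪ M))))
∑-⊆-insert {suc n} q zero (false ∷ S) refl h rewrite SubsetP.∪-identityˡ S = begin
  ∑[ M ∈ allSubsets (suc n) ] (⟦ M ⊆ˢ true ∷ S ⟧ * (q ^ card M * h M))
    ≡⟨ ∑-subsets-∷ (λ M → ⟦ M ⊆ˢ true ∷ S ⟧ * (q ^ card M * h M)) ⟩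
  (∑[ M ∈ allSubsets n ] (⟦ M ⊆ˢ S ⟧ * (q ^ card M * h (false ∷ M))))
    + ∑[ M ∈ allSubsets n ] (⟦ M ⊆ˢ S ⟧ * (q * q ^ card M * h (true ∷ M)))
    ≡⟨ sym (∑-+ (allSubsets n) _ _) ⟩
  ∑[ M ∈ allSubsets n ] (⟦ M ⊆ˢ S ⟧ * (q ^ card M * h (false ∷ M)) + ⟦ M ⊆ˢ S ⟧ * (q * q ^ card M * h (true ∷ M)))
    ≡⟨ ∑-cong (allSubsets n) (λ M →
         trans (distrib q ⟦ M ⊆ˢ S ⟧ (q ^ card M) (h (false ∷ M)) (h (true ∷ M)))
               (cong (λ X → ⟦ M ⊆ˢ S ⟧ * (q ^ card M * (h (false ∷ M) + q * h (true ∷ X))))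
                     (sym (SubsetP.∪-identityˡ M)))) ⟩
  ∑[ M ∈ allSubsets n ] (⟦ M ⊆ˢ S ⟧ * (q ^ card M * (h (false ∷ M) + q * h (true ∷ (∅ ∪ M)))))
    ≡⟨ sym (trans (cong (_+_ rest) (∑-0 (allSubsets n))) (ℤP.+-identityʳ rest)) ⟩
  rest + ∑[ M ∈ allSubsets n ] 0ℤ
    ≡⟨ sym (∑-subsets-∷ (λ M → ⟦ M ⊆ˢ false ∷ S ⟧ * (q ^ card M * (h M + q * h (⁅ zero ⁆ ∪ M))))) ⟩
  ∑[ M ∈ allSubsets (suc n) ] (⟦ M ⊆ˢ false ∷ S ⟧ * (q ^ card M * (h M + q * h (⁅ zero ⁆ ∪ M)))) ∎
  where
  rest : ℤ
  rest = ∑[ M ∈ allSubsets n ] (⟦ M ⊆ˢ S ⟧ * (q ^ card M * (h (false ∷ M) + q * h (true ∷ (∅ ∪ M)))))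
  distrib : ∀ q e c y z → e * (c * y) + e * (q * c * z) ≡ e * (c * (y + q * z))
  distrib = solve-∀
∑-⊆-insert {suc n} q (suc i) (s ∷ S) Sᵢ≡false h = begin
  ∑[ M ∈ allSubsets (suc n) ] (⟦ M ⊆ˢ s ∷ (⁅ i ⁆ ∪ S) ⟧ * (q ^ card M * h M))
    ≡⟨ ∑-subsets-∷ (λ M → ⟦ M ⊆ˢ s ∷ (⁅ i ⁆ ∪ S) ⟧ * (q ^ card M * h M)) ⟩
  (∑[ M ∈ allSubsets n ] (⟦ M ⊆ˢ ⁅ i ⁆ ∪ S ⟧ * (q ^ card M * h (false ∷ M))))
    + ∑[ M ∈ allSubsets n ] (⟦ s ∧ (M ⊆ˢ ⁅ i ⁆ ∪ S) ⟧ * (q * q ^ card M * h (true ∷ M)))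
    ≡⟨ cong₂ _+_ (∑-⊆-insert q i S Sᵢ≡false (h ∘ (false ∷_))) (with-i s) ⟩
  (∑[ M ∈ allSubsets n ] (⟦ M ⊆ˢ S ⟧ * (q ^ card M * (h (false ∷ M) + q * h (false ∷ (⁅ i ⁆ ∪ M))))))
    + ∑[ M ∈ allSubsets n ] (⟦ s ∧ (M ⊆ˢ S) ⟧ * (q * q ^ card M * (h (true ∷ M) + q * h (true ∷ (⁅ i ⁆ ∪ M)))))
    ≡⟨ sym (∑-subsets-∷ (λ M → ⟦ M ⊆ˢ s ∷ S ⟧ * (q ^ card M * (h M + q * h (⁅ suc i ⁆ ∪ M))))) ⟩
  ∑[ M ∈ allSubsets (suc n) ] (⟦ M ⊆ˢ s ∷ S ⟧ * (q ^ card M * (h M + q * h (⁅ suc i ⁆ ∪ M)))) ∎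
  where
  q-inward : ∀ q e c y → e * (q * c * y) ≡ e * (c * (q * y))
  q-inward = solve-∀

  q-outward : ∀ q e c y z → e * (c * (q * y + q * (q * z))) ≡ e * (q * c * (y + q * z))
  q-outward = solve-∀

  with-i : ∀ s →
    ∑[ M ∈ allSubsets n ] (⟦ s ∧ (M ⊆ˢ ⁅ i ⁆ ∪ S) ⟧ * (q * q ^ card M * h (true ∷ M))) ≡
    ∑[ M ∈ allSubsets n ] (⟦ s ∧ (M ⊆ˢ S) ⟧ * (q * q ^ card M * (h (true ∷ M) + q * h (true ∷ (⁅ i ⁆ ∪ M)))))
  with-i false = refl
  with-i true = begin
    ∑[ M ∈ allSubsets n ] (⟦ M ⊆ˢ ⁅ i ⁆ ∪ S ⟧ * (q * q ^ card M * h (true ∷ M)))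
      ≡⟨ ∑-cong (allSubsets n) (λ M → q-inward q ⟦ M ⊆ˢ ⁅ i ⁆ ∪ S ⟧ (q ^ card M) (h (true ∷ M))) ⟩
    ∑[ M ∈ allSubsets n ] (⟦ M ⊆ˢ ⁅ i ⁆ ∪ S ⟧ * (q ^ card M * (q * h (true ∷ M))))
      ≡⟨ ∑-⊆-insert q i S Sᵢ≡false (λ M → q * h (true ∷ M)) ⟩
    ∑[ M ∈ allSubsets n ] (⟦ M ⊆ˢ S ⟧ * (q ^ card M * (q * h (true ∷ M) + q * (q * h (true ∷ (⁅ i ⁆ ∪ M))))))
      ≡⟨ ∑-cong (allSubsets n) (λ M →
           q-outward q ⟦ M ⊆ˢ S ⟧ (q ^ card M) (h (true ∷ M)) (h (true ∷ (⁅ i ⁆ ∪ M)))) ⟩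
    ∑[ M ∈ allSubsets n ] (⟦ M ⊆ˢ S ⟧ * (q * q ^ card M * (h (true ∷ M) + q * h (true ∷ (⁅ i ⁆ ∪ M))))) ∎

∑-disjoint-triples : ∀ q (F : Subset n → ℤ) →
  ∑[ I ∈ allSubsets n ] (F I * ∑[ M ∈ allSubsets n ]
    (q ^ card M * (⟦ disjointˢ M I ⟧ * ∑[ J ∈ allSubsets n ] (F J * ⟦ disjointˢ (M ∪ I) J ⟧)))) ≡
  ∑[ I ∈ allSubsets n ] ∑[ J ∈ allSubsets n ] ∑[ M ∈ allSubsets n ]
    (if disjointᵇ I J ∧ disjointᵇ I M ∧ disjointᵇ J M then q ^ card M * (F I * F J) else 0ℤ)
∑-disjoint-triples {n} q F = begin
  ∑[ I ∈ allSubsets n ] (F I * ∑[ M ∈ allSubsets n ]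
    (q ^ card M * (⟦ disjointˢ M I ⟧ * ∑[ J ∈ allSubsets n ] (F J * ⟦ disjointˢ (M ∪ I) J ⟧))))
    ≡⟨ ∑-cong (allSubsets n) (λ I →
         trans (sym (∑-*ˡ (allSubsets n) (F I) _))
               (∑-cong (allSubsets n) λ M → cong (F I *_) (pull-in (q ^ card M) ⟦ disjointˢ M I ⟧ _))) ⟩
  ∑[ I ∈ allSubsets n ] ∑[ M ∈ allSubsets n ] (F I * ∑[ J ∈ allSubsets n ]
    (q ^ card M * (⟦ disjointˢ M I ⟧ * (F J * ⟦ disjointˢ (M ∪ I) J ⟧))))
    ≡⟨ ∑-cong (allSubsets n) (λ I → ∑-cong (allSubsets n) λ M → sym (∑-*ˡ (allSubsets n) (F I) _)) ⟩
  ∑[ I ∈ allSubsets n ] ∑[ M ∈ allSubsets n ] ∑[ J ∈ allSubsets n ]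
    (F I * (q ^ card M * (⟦ disjointˢ M I ⟧ * (F J * ⟦ disjointˢ (M ∪ I) J ⟧))))
    ≡⟨ ∑-cong (allSubsets n) (λ I → ∑-swap (allSubsets n) (allSubsets n) _) ⟩
  ∑[ I ∈ allSubsets n ] ∑[ J ∈ allSubsets n ] ∑[ M ∈ allSubsets n ]
    (F I * (q ^ card M * (⟦ disjointˢ M I ⟧ * (F J * ⟦ disjointˢ (M ∪ I) J ⟧))))
    ≡⟨ ∑-cong (allSubsets n) (λ I → ∑-cong (allSubsets n) λ J → ∑-cong (allSubsets n) λ M → summand I J M) ⟩
  ∑[ I ∈ allSubsets n ] ∑[ J ∈ allSubsets n ] ∑[ M ∈ allSubsets n ]
    (if disjointᵇ I J ∧ disjointᵇ I M ∧ disjointᵇ J M then q ^ card M * (F I * F J) else 0ℤ) ∎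
  where
  pull-in : ∀ c d (f : Subset n → ℤ) → c * (d * ∑ (allSubsets n) f) ≡ ∑[ J ∈ allSubsets n ] (c * (d * f J))
  pull-in c d f = sym (trans (∑-*ˡ (allSubsets n) c _) (cong (c *_) (∑-*ˡ (allSubsets n) d f)))

  rearrange : ∀ a b e c f g → f * (c * (a * (g * (e * b)))) ≡ e * (a * b) * (c * (f * g))
  rearrange = solve-∀

  summand : ∀ I J M →
    F I * (q ^ card M * (⟦ disjointˢ M I ⟧ * (F J * ⟦ disjointˢ (M ∪ I) J ⟧))) ≡
    (if disjointᵇ I J ∧ disjointᵇ I M ∧ disjointᵇ J M then q ^ card M * (F I * F J) else 0ℤ)
  summand I J M = begin
    F I * (q ^ card M * (⟦ disjointˢ M I ⟧ * (F J * ⟦ disjointˢ (M ∪ I) J ⟧)))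
      ≡⟨ cong₂ (λ a b → F I * (q ^ card M * (⟦ a ⟧ * (F J * ⟦ b ⟧))))
               (disjointˢ-comm M I)
               (trans (disjointˢ-∪ˡ M I J) (BoolP.∧-comm (disjointˢ M J) (disjointˢ I J))) ⟩
    F I * (q ^ card M * (⟦ disjointˢ I M ⟧ * (F J * ⟦ disjointˢ I J ∧ disjointˢ M J ⟧)))
      ≡⟨ cong (λ b → F I * (q ^ card M * (⟦ disjointˢ I M ⟧ * (F J * b))))
              (trans (⟦∧⟧ (disjointˢ I J) (disjointˢ M J))
                     (cong (λ b → ⟦ disjointˢ I J ⟧ * ⟦ b ⟧) (disjointˢ-comm M J))) ⟩
    F I * (q ^ card M * (⟦ disjointˢ I M ⟧ * (F J * (⟦ disjointˢ I J ⟧ * ⟦ disjointˢ J M ⟧))))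
      ≡⟨ rearrange ⟦ disjointˢ I M ⟧ ⟦ disjointˢ J M ⟧ ⟦ disjointˢ I J ⟧ (q ^ card M) (F I) (F J) ⟩
    ⟦ disjointˢ I J ⟧ * (⟦ disjointˢ I M ⟧ * ⟦ disjointˢ J M ⟧) * (q ^ card M * (F I * F J))
      ≡⟨ cong (_* (q ^ card M * (F I * F J)))
              (sym (trans (⟦∧⟧ (disjointˢ I J) (disjointˢ I M ∧ disjointˢ J M))
                          (cong (⟦ disjointˢ I J ⟧ *_) (⟦∧⟧ (disjointˢ I M) (disjointˢ J M))))) ⟩
    ⟦ disjointˢ I J ∧ disjointˢ I M ∧ disjointˢ J M ⟧ * (q ^ card M * (F I * F J))
      ≡⟨ cong (λ b → ⟦ b ⟧ * (q ^ card M * (F I * F J)))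
              (sym (cong₂ _∧_ (disjointᵇ≡disjointˢ I J)
                              (cong₂ _∧_ (disjointᵇ≡disjointˢ I M) (disjointᵇ≡disjointˢ J M)))) ⟩
    ⟦ disjointᵇ I J ∧ disjointᵇ I M ∧ disjointᵇ J M ⟧ * (q ^ card M * (F I * F J))
      ≡⟨ sym (if-then-0 (disjointᵇ I J ∧ disjointᵇ I M ∧ disjointᵇ J M) (q ^ card M * (F I * F J))) ⟩
    (if disjointᵇ I J ∧ disjointᵇ I M ∧ disjointᵇ J M then q ^ card M * (F I * F J) else 0ℤ) ∎

-- Supports and simple roots

nonzeroᵇ-true : ∀ {x} → x ≢ 0ℤ → nonzeroᵇ x ≡ true
nonzeroᵇ-true {x} x≢0 = cong not (⌊⌋-false (x ℤ.≟ 0ℤ) x≢0)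

nonzeroᵇ-false : ∀ {x} → x ≡ 0ℤ → nonzeroᵇ x ≡ false
nonzeroᵇ-false {x} x≡0 = cong not (⌊⌋-true (x ℤ.≟ 0ℤ) x≡0)

support : Vec ℤ n → Subset n
support v = tabulate (λ k → nonzeroᵇ (lookup v k))

supports : List (Vec ℤ n) → Subset n
supports a = ⋃ (map support a)

lookup-support : (v : Vec ℤ n) (k : Fin n) → lookup (support v) k ≡ nonzeroᵇ (lookup v k)
lookup-support v = VecP.lookup∘tabulate _

supportedInᵇ≡⊆ˢ : (J : Subset n) (v : Vec ℤ n) → supportedInᵇ J v ≡ support v ⊆ˢ J
supportedInᵇ≡⊆ˢ J v = trans (allᵇ-cong (allFin _) λ k → cong (λ b → not b ∨ lookup J k) (sym (lookup-support v k)))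
                           (allᵇ-lookup _ (support v) J)

allᵇ-supportedInᵇ : (J : Subset n) (a : List (Vec ℤ n)) → allᵇ (supportedInᵇ J) a ≡ supports a ⊆ˢ J
allᵇ-supportedInᵇ J [] = sym (∅-⊆ˢ J)
allᵇ-supportedInᵇ J (v ∷ a) =
  trans (cong₂ _∧_ (supportedInᵇ≡⊆ˢ J v) (allᵇ-supportedInᵇ J a)) (sym (∪-⊆ˢ (support v) (supports a) J))

supportsMeetᵇ≡ : (u v : Vec ℤ n) → supportsMeetᵇ u v ≡ not (disjointˢ (support u) (support v))
supportsMeetᵇ≡ {n} u v =
  trans (anyᵇ≡not-allᵇ (λ k → nonzeroᵇ (lookup u k) ∧ nonzeroᵇ (lookup v k)) (allFin n))
        (cong not (trans (allᵇ-cong (allFin n) λ k →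
                            cong₂ (λ a b → not (a ∧ b)) (sym (lookup-support u k)) (sym (lookup-support v k)))
                         (allᵇ-lookup _ (support u) (support v))))

crossIncomparable-supportsMeetᵇ : (a b : List (Vec ℤ n)) →
  crossIncomparable supportsMeetᵇ a b ≡ disjointˢ (supports a) (supports b)
crossIncomparable-supportsMeetᵇ [] b = sym (∅-disjointˢ (supports b))
crossIncomparable-supportsMeetᵇ (x ∷ a) b =
  trans (cong₂ _∧_ (meets-x b) (crossIncomparable-supportsMeetᵇ a b)) (sym (disjointˢ-∪ˡ (support x) (supports a) (supports b)))
  where
  meets-x : ∀ b → allᵇ (λ y → not (supportsMeetᵇ x y)) b ≡ disjointˢ (support x) (supports b)
  meets-x [] = sym (trans (disjointˢ-comm (support x) ∅) (∅-disjointˢ (support x)))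
  meets-x (y ∷ b) = trans (cong₂ _∧_ (trans (cong not (supportsMeetᵇ≡ x y)) (BoolP.not-involutive _)) (meets-x b))
                          (sym (disjointˢ-∪ʳ (support x) (support y) (supports b)))

supports-partition : (p : Vec ℤ n → Bool) (s : List (Vec ℤ n)) →
  supports s ≡ supports (filterᵇ p s) ∪ supports (filterᵇ (not ∘ p) s)
supports-partition p [] = sym (SubsetP.∪-identityˡ ∅)
supports-partition p (x ∷ s) = by-cases (p x) refl
  where
  S₁ S₂ : Subset _
  S₁ = supports (filterᵇ p s)
  S₂ = supports (filterᵇ (not ∘ p) s)

  by-cases : ∀ b → p x ≡ b → supports (x ∷ s) ≡ supports (filterᵇ p (x ∷ s)) ∪ supports (filterᵇ (not ∘ p) (x ∷ s))
  by-cases true px rewrite filterᵇ-accept p s px | filterᵇ-reject (not ∘ p) s (cong not px) =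
    trans (cong (support x ∪_) (supports-partition p s)) (sym (SubsetP.∪-assoc (support x) S₁ S₂))
  by-cases false px rewrite filterᵇ-reject p s px | filterᵇ-accept (not ∘ p) s (cong not px) = begin
    support x ∪ supports s        ≡⟨ cong (support x ∪_) (supports-partition p s) ⟩
    support x ∪ (S₁ ∪ S₂)         ≡⟨ sym (SubsetP.∪-assoc (support x) S₁ S₂) ⟩
    (support x ∪ S₁) ∪ S₂         ≡⟨ cong (_∪ S₂) (SubsetP.∪-comm (support x) S₁) ⟩
    (S₁ ∪ support x) ∪ S₂         ≡⟨ SubsetP.∪-assoc S₁ (support x) S₂ ⟩
    S₁ ∪ (support x ∪ S₂)         ∎

rootComparableᵇ-sym : (u v : Vec ℤ n) → rootComparableᵇ u v ≡ rootComparableᵇ v u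
rootComparableᵇ-sym u v = BoolP.∨-comm (rootLeqᵇ u v) (rootLeqᵇ v u)

lookup-simpleRoot : (i k : Fin n) → lookup (simpleRoot i) k ≡ (if ⌊ k Fin.≟ i ⌋ then 1ℤ else 0ℤ)
lookup-simpleRoot i = VecP.lookup∘tabulate _

simpleRoot-self : (i : Fin n) → lookup (simpleRoot i) i ≡ 1ℤ
simpleRoot-self i rewrite lookup-simpleRoot i i with i Fin.≟ i
... | yes _ = refl
... | no i≢i = contradiction refl i≢i

simpleRoot-other : {i k : Fin n} → k ≢ i → lookup (simpleRoot i) k ≡ 0ℤ
simpleRoot-other {i = i} {k} k≢i rewrite lookup-simpleRoot i k with k Fin.≟ i
... | yes k≡i = contradiction k≡i k≢i
... | no _ = refl

support-simpleRoot : (i : Fin n) → support (simpleRoot i) ≡ ⁅ i ⁆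
support-simpleRoot i = trans (VecP.tabulate-cong same-entries) (VecP.tabulate∘lookup ⁅ i ⁆)
  where
  same-entries : ∀ k → nonzeroᵇ (lookup (simpleRoot i) k) ≡ lookup ⁅ i ⁆ k
  same-entries k with k Fin.≟ i
  ... | yes refl = trans (cong nonzeroᵇ (simpleRoot-self i)) (sym (lookup-⁅⁆-self i))
  ... | no k≢i = trans (cong nonzeroᵇ (simpleRoot-other k≢i)) (sym (lookup-⁅⁆-other k≢i))

Semipositive : Vec ℤ n → Set
Semipositive v = (∀ k → 0ℤ ℤ.≤ lookup v k) × ¬ (∀ k → lookup v k ≡ 0ℤ)

simpleRoot-semipositive : (i : Fin n) → Semipositive (simpleRoot i)
simpleRoot-semipositive i = nonnegative , λ zero-vector → contradiction (trans (sym (simpleRoot-self i)) (zero-vector i)) λ ()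
  where
  nonnegative : ∀ k → 0ℤ ℤ.≤ lookup (simpleRoot i) k
  nonnegative k rewrite lookup-simpleRoot i k with ⌊ k Fin.≟ i ⌋
  ... | true = ℤ.+≤+ ℕ.z≤n
  ... | false = ℤ.+≤+ ℕ.z≤n

simpleRoot≤ᵇ : (i : Fin n) (v : Vec ℤ n) → (∀ k → 0ℤ ℤ.≤ lookup v k) → lookup v i ≢ 0ℤ →
  rootLeqᵇ (simpleRoot i) v ≡ true
simpleRoot≤ᵇ i v v≥0 vᵢ≢0 = allᵇ-intro (allFin _) λ k →
  ⌊⌋-true (lookup (simpleRoot i) k ℤ.≤? lookup v k) (entry k)
  where
  entry : ∀ k → lookup (simpleRoot i) k ℤ.≤ lookup v k
  entry k with k Fin.≟ i
  ... | yes refl =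
    subst (ℤ._≤ lookup v i) (sym (simpleRoot-self i)) (ℤP.i<j⇒suc[i]≤j (ℤP.≤∧≢⇒< (v≥0 i) (vᵢ≢0 ∘ sym)))
  ... | no k≢i = subst (ℤ._≤ lookup v k) (sym (simpleRoot-other k≢i)) (v≥0 k)

simpleRoot≰ᵇ : (i : Fin n) (v : Vec ℤ n) → lookup v i ≡ 0ℤ → rootLeqᵇ (simpleRoot i) v ≡ false
simpleRoot≰ᵇ i v vᵢ≡0 = allᵇ-reject (allFin _) (MembershipP.∈-allFin i)
  (⌊⌋-false (lookup (simpleRoot i) i ℤ.≤? lookup v i) 1≰vᵢ)
  where
  1≰vᵢ : ¬ (lookup (simpleRoot i) i ℤ.≤ lookup v i)
  1≰vᵢ rewrite simpleRoot-self i | vᵢ≡0 = λ { (ℤ.+≤+ ()) }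

≰simpleRootᵇ : (i : Fin n) (v : Vec ℤ n) → Semipositive v → lookup v i ≡ 0ℤ → rootLeqᵇ v (simpleRoot i) ≡ false
≰simpleRootᵇ i v (v≥0 , v≢0) vᵢ≡0 = BoolP.¬-not λ v≤αᵢ → v≢0 λ k →
  entry k (toWitness (Equivalence.from BoolP.T-≡ (allᵇ-elim (allFin _) v≤αᵢ (MembershipP.∈-allFin k))))
  where
  entry : ∀ k → lookup v k ℤ.≤ lookup (simpleRoot i) k → lookup v k ≡ 0ℤ
  entry k vₖ≤ with k Fin.≟ i
  ... | yes refl = vᵢ≡0
  ... | no k≢i = ℤP.≤-antisym (subst (lookup v k ℤ.≤_) (simpleRoot-other k≢i) vₖ≤) (v≥0 k)

rootComparable-simpleRoot : (i : Fin n) (v : Vec ℤ n) → Semipositive v →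
  rootComparableᵇ (simpleRoot i) v ≡ lookup (support v) i
rootComparable-simpleRoot i v (v≥0 , v≢0) with lookup v i ℤ.≟ 0ℤ
... | no vᵢ≢0 = trans (cong (_∨ rootLeqᵇ v (simpleRoot i)) (simpleRoot≤ᵇ i v v≥0 vᵢ≢0))
                      (sym (trans (lookup-support v i) (nonzeroᵇ-true vᵢ≢0)))
... | yes vᵢ≡0 = trans (cong₂ _∨_ (simpleRoot≰ᵇ i v vᵢ≡0) (≰simpleRootᵇ i v (v≥0 , v≢0) vᵢ≡0))
                       (sym (trans (lookup-support v i) (nonzeroᵇ-false vᵢ≡0)))

incomparable-simpleRoot : (i : Fin n) {a : List (Vec ℤ n)} → All Semipositive a →
  allᵇ (λ y → not (rootComparableᵇ (simpleRoot i) y)) a ≡ not (lookup (supports a) i)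
incomparable-simpleRoot i [] = cong not (sym (VecP.lookup-replicate i false))
incomparable-simpleRoot i {v ∷ a} (v⁺ ∷ a⁺) = begin
  not (rootComparableᵇ (simpleRoot i) v) ∧ allᵇ (λ y → not (rootComparableᵇ (simpleRoot i) y)) a
    ≡⟨ cong₂ (λ b c → not b ∧ c) (rootComparable-simpleRoot i v v⁺) (incomparable-simpleRoot i a⁺) ⟩
  not (lookup (support v) i) ∧ not (lookup (supports a) i)
    ≡⟨ sym (deMorgan₂ (lookup (support v) i) (lookup (supports a) i)) ⟩
  not (lookup (support v) i ∨ lookup (supports a) i)
    ≡⟨ cong not (sym (VecP.lookup-zipWith _∨_ i (support v) (supports a))) ⟩
  not (lookup (supports (v ∷ a)) i) ∎

IsSimple : Vec ℤ n → Set
IsSimple {n} v = ∃ λ (i : Fin n) → v ≡ simpleRoot i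

crossIncomparable-simples : {a b : List (Vec ℤ n)} → All IsSimple a → All Semipositive b →
  crossIncomparable rootComparableᵇ a b ≡ disjointˢ (supports a) (supports b)
crossIncomparable-simples {b = b} [] b⁺ = sym (∅-disjointˢ (supports b))
crossIncomparable-simples {a = .(simpleRoot i) ∷ a} {b} ((i , refl) ∷ a-simple) b⁺ = begin
  allᵇ (λ y → not (rootComparableᵇ (simpleRoot i) y)) b ∧ crossIncomparable rootComparableᵇ a b
    ≡⟨ cong₂ _∧_ (incomparable-simpleRoot i b⁺) (crossIncomparable-simples a-simple b⁺) ⟩
  not (lookup (supports b) i) ∧ disjointˢ (supports a) (supports b)
    ≡⟨ cong (_∧ disjointˢ (supports a) (supports b))
            (sym (trans (cong (λ A → disjointˢ A (supports b)) (support-simpleRoot i)) (⁅⁆-disjointˢ i (supports b)))) ⟩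
  disjointˢ (support (simpleRoot i)) (supports b) ∧ disjointˢ (supports a) (supports b)
    ≡⟨ sym (disjointˢ-∪ˡ (support (simpleRoot i)) (supports a) (supports b)) ⟩
  disjointˢ (supports (simpleRoot i ∷ a)) (supports b) ∎

reflection-of-zero : {A : CartanMatrix n} (i : Fin n) → A i i ≡ + 2 → (v : Vec ℤ n) →
  (∀ k → lookup (reflect A i v) k ≡ 0ℤ) → ∀ k → lookup v k ≡ 0ℤ
reflection-of-zero {n} {A} i Aᵢᵢ≡2 v sᵢv≡0 = v≡0
  where
  lookup-reflect : ∀ k → lookup (reflect A i v) k ≡ (if ⌊ k Fin.≟ i ⌋ then lookup v k - pairing A i v else lookup v k)
  lookup-reflect = VecP.lookup∘tabulate _

  off-i : ∀ {k} → k ≢ i → lookup v k ≡ 0ℤ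
  off-i {k} k≢i = trans (sym (cong (λ b → if b then lookup v k - pairing A i v else lookup v k) (⌊⌋-false (k Fin.≟ i) k≢i)))
                        (trans (sym (lookup-reflect k)) (sᵢv≡0 k))

  pairing-single : pairing A i v ≡ A i i * lookup v i
  pairing-single = ∑-allFin-single (λ j → A i j * lookup v j) i λ j j≢i →
    trans (cong (A i j *_) (off-i j≢i)) (ℤP.*-zeroʳ (A i j))

  x-2x : ∀ x → x - + 2 * x ≡ - x
  x-2x = solve-∀

  on-i : lookup v i ≡ 0ℤ
  on-i = ℤP.neg-injective (begin
    - lookup v i                       ≡⟨ sym (x-2x (lookup v i)) ⟩
    lookup v i - + 2 * lookup v i      ≡⟨ cong (λ a → lookup v i - a * lookup v i) (sym Aᵢᵢ≡2) ⟩
    lookup v i - A i i * lookup v i    ≡⟨ cong (_-_ (lookup v i)) (sym pairing-single) ⟩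
    lookup v i - pairing A i v
      ≡⟨ cong (λ b → if b then lookup v i - pairing A i v else lookup v i) (sym (⌊⌋-true (i Fin.≟ i) refl)) ⟩
    (if ⌊ i Fin.≟ i ⌋ then lookup v i - pairing A i v else lookup v i)
      ≡⟨ sym (lookup-reflect i) ⟩
    lookup (reflect A i v) i
      ≡⟨ sᵢv≡0 i ⟩
    0ℤ ∎)

  v≡0 : ∀ k → lookup v k ≡ 0ℤ
  v≡0 k with k Fin.≟ i
  ... | yes refl = on-i
  ... | no k≢i = off-i k≢i

root-semipositive : {A : CartanMatrix n} → IsGCM A → (v : Vec ℤ n) → IsPositiveRoot A v → Semipositive v
root-semipositive {A = A} gcm v (root , v≥0) = v≥0 , nonzero root
  where
  nonzero : ∀ {v} → IsRoot A v → ¬ (∀ k → lookup v k ≡ 0ℤ)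
  nonzero (simple i) = proj₂ (simpleRoot-semipositive i)
  nonzero (reflected i {v} root) sᵢv≡0 = nonzero root (reflection-of-zero {A = A} i (proj₁ gcm i) v sᵢv≡0)

isSimpleᵇ-sound : (v : Vec ℤ n) → isSimpleᵇ v ≡ true → IsSimple v
isSimpleᵇ-sound v v-simple with anyᵇ-elim (allFin _) v-simple
... | i , v≟αᵢ = i , toWitness (Equivalence.from BoolP.T-≡ v≟αᵢ)

isSimpleᵇ-simpleRoot : (i : Fin n) → isSimpleᵇ (simpleRoot i) ≡ true
isSimpleᵇ-simpleRoot i =
  anyᵇ-intro (allFin _) (MembershipP.∈-allFin i) (⌊⌋-true (VecP.≡-dec ℤ._≟_ (simpleRoot i) (simpleRoot i)) refl)

lookup-supports : ∀ {x : Vec ℤ n} {a} k → x ∈ a → lookup (support x) k ≡ true → lookup (supports a) k ≡ true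
lookup-supports {x = x} {x ∷ a} k (here refl) xₖ =
  trans (VecP.lookup-zipWith _∨_ k (support x) (supports a)) (cong (_∨ lookup (supports a) k) xₖ)
lookup-supports {a = y ∷ a} k (there x∈a) xₖ =
  trans (VecP.lookup-zipWith _∨_ k (support y) (supports a))
        (trans (cong (lookup (support y) k ∨_) (lookup-supports k x∈a xₖ)) (BoolP.∨-zeroʳ _))

lookup-supports-simples : (i : Fin n) {a : List (Vec ℤ n)} → All (λ y → simpleRoot i ≢ y × IsSimple y) a →
  lookup (supports a) i ≡ false
lookup-supports-simples i [] = VecP.lookup-replicate i false
lookup-supports-simples i {.(simpleRoot j) ∷ a} ((αᵢ≢αⱼ , j , refl) ∷ rest) = begin
  lookup (support (simpleRoot j) ∪ supports a) i
    ≡⟨ VecP.lookup-zipWith _∨_ i (support (simpleRoot j)) (supports a) ⟩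
  lookup (support (simpleRoot j)) i ∨ lookup (supports a) i
    ≡⟨ cong₂ _∨_ (trans (cong (λ A → lookup A i) (support-simpleRoot j)) (lookup-⁅⁆-other (αᵢ≢αⱼ ∘ cong simpleRoot)))
                 (lookup-supports-simples i rest) ⟩
  false ∎

module _ (q : ℤ) where

  weight-∷-simpleRoot : (i : Fin n) {a : List (Vec ℤ n)} → All Semipositive a → lookup (supports a) i ≡ false →
    weight rootComparableᵇ q (simpleRoot i ∷ a) ≡ q * weight rootComparableᵇ q a
  weight-∷-simpleRoot i {a} a⁺ i∉a rewrite incomparable-simpleRoot i a⁺ | i∉a =
    x∙yz≈y∙xz ⟦ pairwiseIncomparable rootComparableᵇ a ⟧ q (q ^ length a)

  ∑-sublists-simples : {xs : List (Vec ℤ n)} → Unique.Unique xs → All IsSimple xs → (ψ : Subset n → ℤ) →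
    ∑[ a ∈ sublists xs ] (weight rootComparableᵇ q a * ψ (supports a)) ≡
    ∑[ M ∈ allSubsets n ] (⟦ M ⊆ˢ supports xs ⟧ * (q ^ card M * ψ M))
  ∑-sublists-simples {n} [] [] ψ =
    trans (ℤP.+-identityʳ _) (sym (trans (∑-⊆-∅ (λ M → q ^ card M * ψ M)) (cong (λ c → q ^ c * ψ ∅) (card-∅ {n}))))
  ∑-sublists-simples {n} {.(simpleRoot i) ∷ ys} (αᵢ∉ys ∷ ys-unique) ((i , refl) ∷ ys-simple) ψ = begin
    ∑[ a ∈ sublists (simpleRoot i ∷ ys) ] (w a * ψ (supports a))
      ≡⟨ ∑-sublists-∷ (simpleRoot i) ys _ ⟩
    (∑[ a ∈ sublists ys ] (w a * ψ (supports a)))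
      + ∑[ a ∈ sublists ys ] (w (simpleRoot i ∷ a) * ψ (support (simpleRoot i) ∪ supports a))
      ≡⟨ cong (_+_ (∑[ a ∈ sublists ys ] (w a * ψ (supports a)))) (∑-congᴬ (All-sublists ys-facts) add-αᵢ) ⟩
    (∑[ a ∈ sublists ys ] (w a * ψ (supports a)))
      + ∑[ a ∈ sublists ys ] (w a * (q * ψ (⁅ i ⁆ ∪ supports a)))
      ≡⟨ cong₂ _+_ (∑-sublists-simples ys-unique ys-simple ψ)
                   (∑-sublists-simples ys-unique ys-simple (λ M → q * ψ (⁅ i ⁆ ∪ M))) ⟩
    (∑[ M ∈ allSubsets n ] (⟦ M ⊆ˢ supports ys ⟧ * (q ^ card M * ψ M)))
      + ∑[ M ∈ allSubsets n ] (⟦ M ⊆ˢ supports ys ⟧ * (q ^ card M * (q * ψ (⁅ i ⁆ ∪ M))))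
      ≡⟨ trans (sym (∑-+ (allSubsets n) _ _)) (∑-cong (allSubsets n) λ M →
           distrib ⟦ M ⊆ˢ supports ys ⟧ (q ^ card M) (ψ M) (q * ψ (⁅ i ⁆ ∪ M))) ⟩
    ∑[ M ∈ allSubsets n ] (⟦ M ⊆ˢ supports ys ⟧ * (q ^ card M * (ψ M + q * ψ (⁅ i ⁆ ∪ M))))
      ≡⟨ sym (∑-⊆-insert q i (supports ys) (lookup-supports-simples i ys-facts) ψ) ⟩
    ∑[ M ∈ allSubsets n ] (⟦ M ⊆ˢ ⁅ i ⁆ ∪ supports ys ⟧ * (q ^ card M * ψ M))
      ≡⟨ ∑-cong (allSubsets n) (λ M →
           cong (λ A → ⟦ M ⊆ˢ A ∪ supports ys ⟧ * (q ^ card M * ψ M)) (sym (support-simpleRoot i))) ⟩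
    ∑[ M ∈ allSubsets n ] (⟦ M ⊆ˢ supports (simpleRoot i ∷ ys) ⟧ * (q ^ card M * ψ M)) ∎
    where
    w : List (Vec ℤ n) → ℤ
    w = weight rootComparableᵇ q

    ys-facts : All (λ y → simpleRoot i ≢ y × IsSimple y) ys
    ys-facts = All.zip (αᵢ∉ys , ys-simple)

    add-αᵢ : ∀ {a} → All (λ y → simpleRoot i ≢ y × IsSimple y) a →
      w (simpleRoot i ∷ a) * ψ (support (simpleRoot i) ∪ supports a) ≡ w a * (q * ψ (⁅ i ⁆ ∪ supports a))
    add-αᵢ {a} a-facts = begin
      w (simpleRoot i ∷ a) * ψ (support (simpleRoot i) ∪ supports a)
        ≡⟨ cong₂ _*_ (weight-∷-simpleRoot i a⁺ (lookup-supports-simples i a-facts))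
                     (cong (λ A → ψ (A ∪ supports a)) (support-simpleRoot i)) ⟩
      q * w a * ψ (⁅ i ⁆ ∪ supports a)
        ≡⟨ xy∙z≈y∙xz q (w a) (ψ (⁅ i ⁆ ∪ supports a)) ⟩
      w a * (q * ψ (⁅ i ⁆ ∪ supports a)) ∎
      where
      a⁺ : All Semipositive a
      a⁺ = All.map (λ { (_ , j , refl) → simpleRoot-semipositive j }) a-facts

    distrib : ∀ e c y z → e * (c * y) + e * (c * z) ≡ e * (c * (y + z))
    distrib = solve-∀

supportsMeetᵇ-sym : (u v : Vec ℤ n) → supportsMeetᵇ u v ≡ supportsMeetᵇ v u
supportsMeetᵇ-sym u v =
  trans (supportsMeetᵇ≡ u v) (trans (cong not (disjointˢ-comm (support u) (support v))) (sym (supportsMeetᵇ≡ v u)))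

doubledComparableᵇ-sym : (x y : DElt n) → doubledComparableᵇ x y ≡ doubledComparableᵇ y x
doubledComparableᵇ-sym (top u) (top v) = rootComparableᵇ-sym u v
doubledComparableᵇ-sym (bot u) (bot v) = rootComparableᵇ-sym u v
doubledComparableᵇ-sym (top u) (bot v) = supportsMeetᵇ-sym u v
doubledComparableᵇ-sym (bot u) (top v) = supportsMeetᵇ-sym u v

isTop : DElt n → Bool
isTop (top _) = true
isTop (bot _) = false

filter-isTop : (xs ys : List (Vec ℤ n)) → filterᵇ isTop (map top xs ++ map bot ys) ≡ map top xs
filter-isTop xs ys = begin
  filterᵇ isTop (map top xs ++ map bot ys)
    ≡⟨ ListP.filter-++ (T? ∘ isTop) (map top xs) (map bot ys) ⟩
  filterᵇ isTop (map top xs) ++ filterᵇ isTop (map bot ys)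
    ≡⟨ cong₂ _++_ (ListP.filter-all (T? ∘ isTop) (AllP.map⁺ (All.universal (λ _ → tt) xs)))
                  (ListP.filter-none (T? ∘ isTop) (AllP.map⁺ (All.universal (λ _ ()) ys))) ⟩
  map top xs ++ []
    ≡⟨ ListP.++-identityʳ (map top xs) ⟩
  map top xs ∎

filter-isBottom : (xs ys : List (Vec ℤ n)) → filterᵇ (not ∘ isTop) (map top xs ++ map bot ys) ≡ map bot ys
filter-isBottom xs ys = begin
  filterᵇ (not ∘ isTop) (map top xs ++ map bot ys)
    ≡⟨ ListP.filter-++ (T? ∘ not ∘ isTop) (map top xs) (map bot ys) ⟩
  filterᵇ (not ∘ isTop) (map top xs) ++ filterᵇ (not ∘ isTop) (map bot ys)
    ≡⟨ cong₂ _++_ (ListP.filter-none (T? ∘ not ∘ isTop) (AllP.map⁺ (All.universal (λ _ ()) xs)))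
                  (ListP.filter-all (T? ∘ not ∘ isTop) (AllP.map⁺ (All.universal (λ _ → tt) ys))) ⟩
  map bot ys ∎

-- Generating functions of a finite root system

module RootPoset {n : ℕ} (A : CartanMatrix n) (gcm : IsGCM A)
                 (L : List (Vec ℤ n)) (roots : PositiveRootList A L) (q : ℤ) where

  simples nonSimples : List (Vec ℤ n)
  simples = filterᵇ isSimpleᵇ L
  nonSimples = filterᵇ (not ∘ isSimpleᵇ) L

  w : List (Vec ℤ n) → ℤ
  w = weight rootComparableᵇ q

  G : Subset n → ℤ
  G T = ∑[ b ∈ sublists nonSimples ] (w b * δ (supports b) T)

  nonSimples-semipositive : All Semipositive nonSimples
  nonSimples-semipositive = AllP.filter⁺ (T? ∘ not ∘ isSimpleᵇ)
    (All.tabulate λ {v} v∈L → root-semipositive gcm v (Equivalence.to (proj₂ roots v) v∈L))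

  simples-simple : All IsSimple simples
  simples-simple = All.map (λ {v} v-simple → isSimpleᵇ-sound v (Equivalence.to BoolP.T-≡ v-simple))
                           (AllP.all-filter (T? ∘ isSimpleᵇ) L)

  simples-unique : Unique.Unique simples
  simples-unique = UniqueP.filter⁺ (T? ∘ isSimpleᵇ) (proj₁ roots)

  supports-simples : supports simples ≡ full
  supports-simples = trans (sym (VecP.tabulate∘lookup (supports simples)))
    (trans (VecP.tabulate-cong λ k →
              trans (lookup-supports k (αₖ∈simples k) (αₖ-support k)) (sym (VecP.lookup-replicate k true)))
           (VecP.tabulate∘lookup full))
    where
    αₖ∈simples : (k : Fin n) → simpleRoot k ∈ simples
    αₖ∈simples k = MembershipP.∈-filter⁺ (T? ∘ isSimpleᵇ)
      (Equivalence.from (proj₂ roots (simpleRoot k)) (simple k , proj₁ (simpleRoot-semipositive k)))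
      (Equivalence.from BoolP.T-≡ (isSimpleᵇ-simpleRoot k))
    αₖ-support : (k : Fin n) → lookup (support (simpleRoot k)) k ≡ true
    αₖ-support k = trans (cong (λ S → lookup S k) (support-simpleRoot k)) (lookup-⁅⁆-self k)

  ∑-antichains-by-support : (Ψ : Subset n → ℤ) →
    ∑[ a ∈ sublists L ] (w a * Ψ (supports a)) ≡
    ∑[ T ∈ allSubsets n ] (G T * ∑[ M ∈ allSubsets n ] (q ^ card M * (⟦ disjointˢ M T ⟧ * Ψ (M ∪ T))))
  ∑-antichains-by-support Ψ = begin
    ∑[ a ∈ sublists L ] (w a * Ψ (supports a))
      ≡⟨ ∑-cong (sublists L) (λ a → cong (λ S → w a * Ψ S) (supports-partition isSimpleᵇ a)) ⟩
    ∑[ a ∈ sublists L ] (w a * Ψ (supports (filterᵇ isSimpleᵇ a) ∪ supports (filterᵇ (not ∘ isSimpleᵇ) a)))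
      ≡⟨ ∑-antichains-partition rootComparableᵇ rootComparableᵇ-sym q isSimpleᵇ L
           (λ a b → Ψ (supports a ∪ supports b)) ⟩
    ∑[ a ∈ sublists simples ] ∑[ b ∈ sublists nonSimples ]
      (w a * w b * ⟦ crossIncomparable rootComparableᵇ a b ⟧ * Ψ (supports a ∪ supports b))
      ≡⟨ ∑-congᴬ (All-sublists simples-simple) (λ {a} a-simple →
           trans (∑-congᴬ (All-sublists nonSimples-semipositive) (split-off-a a-simple))
                 (∑-*ˡ (sublists nonSimples) (w a) _)) ⟩
    ∑[ a ∈ sublists simples ] (w a * ψ (supports a))
      ≡⟨ ∑-sublists-simples q simples-unique simples-simple ψ ⟩
    ∑[ M ∈ allSubsets n ] (⟦ M ⊆ˢ supports simples ⟧ * (q ^ card M * ψ M))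
      ≡⟨ ∑-cong (allSubsets n) (λ M →
           trans (cong (λ S → ⟦ M ⊆ˢ S ⟧ * (q ^ card M * ψ M)) supports-simples)
                 (trans (cong (λ b → ⟦ b ⟧ * (q ^ card M * ψ M)) (⊆ˢ-full M)) (ℤP.*-identityˡ _))) ⟩
    ∑[ M ∈ allSubsets n ] (q ^ card M * ψ M)
      ≡⟨ ∑-cong (allSubsets n) (λ M → cong (q ^ card M *_)
           (∑-fibres (sublists nonSimples) w supports (λ T → ⟦ disjointˢ M T ⟧ * Ψ (M ∪ T)))) ⟩
    ∑[ M ∈ allSubsets n ] (q ^ card M * ∑[ T ∈ allSubsets n ] (G T * (⟦ disjointˢ M T ⟧ * Ψ (M ∪ T))))
      ≡⟨ ∑-exchange (allSubsets n) (allSubsets n) (λ M → q ^ card M) G (λ M T → ⟦ disjointˢ M T ⟧ * Ψ (M ∪ T)) ⟩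
    ∑[ T ∈ allSubsets n ] (G T * ∑[ M ∈ allSubsets n ] (q ^ card M * (⟦ disjointˢ M T ⟧ * Ψ (M ∪ T)))) ∎
    where
    ψ : Subset n → ℤ
    ψ M = ∑[ b ∈ sublists nonSimples ] (w b * (⟦ disjointˢ M (supports b) ⟧ * Ψ (M ∪ supports b)))

    reassociate : ∀ x y z u → x * y * z * u ≡ x * (y * (z * u))
    reassociate = solve-∀

    split-off-a : ∀ {a b} → All IsSimple a → All Semipositive b →
      w a * w b * ⟦ crossIncomparable rootComparableᵇ a b ⟧ * Ψ (supports a ∪ supports b) ≡
      w a * (w b * (⟦ disjointˢ (supports a) (supports b) ⟧ * Ψ (supports a ∪ supports b)))
    split-off-a {a} {b} a-simple b⁺ =
      trans (cong (λ c → w a * w b * ⟦ c ⟧ * Ψ (supports a ∪ supports b)) (crossIncomparable-simples a-simple b⁺))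
            (reassociate (w a) (w b) ⟦ disjointˢ (supports a) (supports b) ⟧ (Ψ (supports a ∪ supports b)))

  Cat-expansion : (K : Subset n) → Cat L K q ≡ ∑[ T ∈ allSubsets n ] (G T * kron (shear (1ℤ + q)) K T)
  Cat-expansion K = begin
    Cat L K q
      ≡⟨ antichainGF-∑ rootComparableᵇ (filterᵇ (supportedInᵇ K) L) q ⟩
    ∑ (sublists (filterᵇ (supportedInᵇ K) L)) w
      ≡⟨ ∑-sublists-filter (supportedInᵇ K) L w ⟩
    ∑[ a ∈ sublists L ] (⟦ allᵇ (supportedInᵇ K) a ⟧ * w a)
      ≡⟨ ∑-cong (sublists L) (λ a → trans (ℤP.*-comm ⟦ allᵇ (supportedInᵇ K) a ⟧ (w a))
                                          (cong (λ b → w a * ⟦ b ⟧) (allᵇ-supportedInᵇ K a))) ⟩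
    ∑[ a ∈ sublists L ] (w a * ⟦ supports a ⊆ˢ K ⟧)
      ≡⟨ ∑-antichains-by-support (λ X → ⟦ X ⊆ˢ K ⟧) ⟩
    ∑[ T ∈ allSubsets n ] (G T * ∑[ M ∈ allSubsets n ] (q ^ card M * (⟦ disjointˢ M T ⟧ * ⟦ M ∪ T ⊆ˢ K ⟧)))
      ≡⟨ ∑-cong (allSubsets n) (λ T → cong (G T *_) (∑-disjoint-union-⊆ q K T)) ⟩
    ∑[ T ∈ allSubsets n ] (G T * kron (shear (1ℤ + q)) K T) ∎

  CatPlus-expansion : (J : Subset n) → CatPlus L J q ≡ ∑[ T ∈ allSubsets n ] (G T * kron (shear q) J T)
  CatPlus-expansion J = begin
    CatPlus L J q
      ≡⟨ ∑-filter (_⊆ᵇ J) (allSubsets n) (λ K → (- 1ℤ) ^ (card J ∸ card K) * Cat L K q) ⟩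
    ∑[ K ∈ allSubsets n ] (⟦ K ⊆ᵇ J ⟧ * ((- 1ℤ) ^ (card J ∸ card K) * Cat L K q))
      ≡⟨ ∑-shear-transform (- 1ℤ) (1ℤ + q) J (λ K → Cat L K q) G Cat-expansion ⟩
    ∑[ T ∈ allSubsets n ] (G T * kron (shear (- 1ℤ + (1ℤ + q))) J T)
      ≡⟨ ∑-cong (allSubsets n) (λ T → cong (λ x → G T * kron (shear x) J T)
           (trans (sym (ℤP.+-assoc (- 1ℤ) 1ℤ q)) (ℤP.+-identityˡ q))) ⟩
    ∑[ T ∈ allSubsets n ] (G T * kron (shear q) J T) ∎

  CatPlusPlus≡G : (I : Subset n) → CatPlusPlus L I q ≡ G I
  CatPlusPlus≡G I = begin
    CatPlusPlus L I q
      ≡⟨ ∑-filter (_⊆ᵇ I) (allSubsets n) (λ K → (- q) ^ (card I ∸ card K) * CatPlus L K q) ⟩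
    ∑[ K ∈ allSubsets n ] (⟦ K ⊆ᵇ I ⟧ * ((- q) ^ (card I ∸ card K) * CatPlus L K q))
      ≡⟨ ∑-shear-transform (- q) q I (λ K → CatPlus L K q) G CatPlus-expansion ⟩
    ∑[ T ∈ allSubsets n ] (G T * kron (shear (- q + q)) I T)
      ≡⟨ ∑-cong (allSubsets n) (λ T → trans (cong (λ x → G T * kron (shear x) I T) (ℤP.+-inverseˡ q))
                                            (ℤP.*-comm (G T) (δ I T))) ⟩
    ∑[ T ∈ allSubsets n ] (δ I T * G T)
      ≡⟨ ∑-δ I G ⟩
    G I ∎

  doubledAntichainGF-expansion : doubledAntichainGF L q ≡
    ∑[ a ∈ sublists L ] (w a * ∑[ J ∈ allSubsets n ] (G J * ⟦ disjointˢ (supports a) J ⟧))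
  doubledAntichainGF-expansion = begin
    doubledAntichainGF L q
      ≡⟨ antichainGF-∑ doubledComparableᵇ D q ⟩
    ∑ (sublists D) wᴰ
      ≡⟨ ∑-cong (sublists D) (λ s → sym (ℤP.*-identityʳ (wᴰ s))) ⟩
    ∑[ s ∈ sublists D ] (wᴰ s * 1ℤ)
      ≡⟨ ∑-antichains-partition doubledComparableᵇ doubledComparableᵇ-sym q isTop D (λ _ _ → 1ℤ) ⟩
    ∑[ a ∈ sublists (filterᵇ isTop D) ] ∑[ b ∈ sublists (filterᵇ (not ∘ isTop) D) ] summand a b
      ≡⟨ cong₂ (λ X Y → ∑[ a ∈ sublists X ] ∑[ b ∈ sublists Y ] summand a b)
               (filter-isTop L nonSimples) (filter-isBottom L nonSimples) ⟩
    ∑[ a ∈ sublists (map top L) ] ∑[ b ∈ sublists (map bot nonSimples) ] summand a b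
      ≡⟨ trans (∑-sublists-map top L _) (∑-cong (sublists L) (λ a → ∑-sublists-map bot nonSimples (summand (map top a)))) ⟩
    ∑[ a ∈ sublists L ] ∑[ b ∈ sublists nonSimples ] summand (map top a) (map bot b)
      ≡⟨ ∑-cong (sublists L) (λ a →
           trans (∑-cong (sublists nonSimples) (top-bottom a)) (∑-*ˡ (sublists nonSimples) (w a) _)) ⟩
    ∑[ a ∈ sublists L ] (w a * ∑[ b ∈ sublists nonSimples ] (w b * ⟦ disjointˢ (supports a) (supports b) ⟧))
      ≡⟨ ∑-cong (sublists L) (λ a → cong (w a *_)
           (∑-fibres (sublists nonSimples) w supports (λ J → ⟦ disjointˢ (supports a) J ⟧))) ⟩
    ∑[ a ∈ sublists L ] (w a * ∑[ J ∈ allSubsets n ] (G J * ⟦ disjointˢ (supports a) J ⟧)) ∎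
    where
    D : List (DElt n)
    D = doubledElements L

    wᴰ : List (DElt n) → ℤ
    wᴰ = weight doubledComparableᵇ q

    summand : List (DElt n) → List (DElt n) → ℤ
    summand a b = wᴰ a * wᴰ b * ⟦ crossIncomparable doubledComparableᵇ a b ⟧ * 1ℤ

    top-bottom : ∀ a b → summand (map top a) (map bot b) ≡ w a * (w b * ⟦ disjointˢ (supports a) (supports b) ⟧)
    top-bottom a b = begin
      summand (map top a) (map bot b)
        ≡⟨ ℤP.*-identityʳ _ ⟩
      wᴰ (map top a) * wᴰ (map bot b) * ⟦ crossIncomparable doubledComparableᵇ (map top a) (map bot b) ⟧
        ≡⟨ cong₂ _*_ (cong₂ _*_ (weight-map top doubledComparableᵇ q a) (weight-map bot doubledComparableᵇ q b))
                     (cong ⟦_⟧ (trans (crossIncomparable-map top bot doubledComparableᵇ a b)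
                                      (crossIncomparable-supportsMeetᵇ a b))) ⟩
      w a * w b * ⟦ disjointˢ (supports a) (supports b) ⟧
        ≡⟨ ℤP.*-assoc (w a) (w b) _ ⟩
      w a * (w b * ⟦ disjointˢ (supports a) (supports b) ⟧) ∎

proposition4p8 : {n : ℕ} (A : CartanMatrix n) → IsGCM A →
    (L : List (Vec ℤ n)) → PositiveRootList A L →
    (q : ℤ) → doubledAntichainGF L q ≡ tripleSum L q
proposition4p8 {n} A gcm L roots q = begin
  doubledAntichainGF L q
    ≡⟨ doubledAntichainGF-expansion ⟩
  ∑[ a ∈ sublists L ] (w a * Ψ (supports a))
    ≡⟨ ∑-antichains-by-support Ψ ⟩
  ∑[ I ∈ allSubsets n ] (G I * ∑[ M ∈ allSubsets n ] (q ^ card M * (⟦ disjointˢ M I ⟧ * Ψ (M ∪ I))))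
    ≡⟨ ∑-disjoint-triples q G ⟩
  ∑[ I ∈ allSubsets n ] ∑[ J ∈ allSubsets n ] ∑[ M ∈ allSubsets n ]
    (if disjointᵇ I J ∧ disjointᵇ I M ∧ disjointᵇ J M then q ^ card M * (G I * G J) else 0ℤ)
    ≡⟨ ∑-cong (allSubsets n) (λ I → ∑-cong (allSubsets n) λ J → ∑-cong (allSubsets n) λ M →
         cong (λ x → if disjointᵇ I J ∧ disjointᵇ I M ∧ disjointᵇ J M then q ^ card M * x else 0ℤ)
              (sym (cong₂ _*_ (CatPlusPlus≡G I) (CatPlusPlus≡G J)))) ⟩
  tripleSum L q ∎
  where
  open RootPoset A gcm L roots q

  Ψ : Subset n → ℤ
  Ψ X = ∑[ J ∈ allSubsets n ] (G J * ⟦ disjointˢ X J ⟧)
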